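{- Let $B$ be the skew-symmetric matrix of a quiver of type $X_6$. Then the coefficient-free cluster algebra $\mathcal A(B)$ has exponential growth.
   Context: A skew-symmetric integer matrix $B$ is encoded by a quiver/diagram with an arrow $i\to j$ of weight $b_{ij}^2$ when $b_{ij}>0$. $X_6$ is the quiver with vertices $c,a_1,b_1,a_2,b_2,e$ and arrows $c\to a_i$, a double arrow $a_i\Rightarrow b_i$ (i.e. $b_{a_ib_i}=2$), $b_i\to c$ for $i=1,2$, and $c\to e$. $B$ is of type $X_6$ if it is obtained, up to simultaneous permutation of rows and columns, by iterated matrix mutations ($\mu_k(B)=B'$, $b'_{ij}=-b_{ij}$ if $k\in\{i,j\}$, else $b'_{ij}=b_{ij}+\tfrac12(|b_{ik}|b_{kj}+b_{ik}|b_{kj}|)$) from the matrix of $X_6$ or of its opposite. The coefficient-free cluster algebra $\mathcal A(B)$ is built from the initial seed $((x_1,\dots,x_n),B)$ by seed mutations $x_k\mapsto(\prod x_i^{[b_{ik}]_+}+\prod x_i^{[-b_{ik}]_+})/x_k$; its exchange graph is the $n$-regular tree of seeds with vertices identified when clusters coincide as sets. With $f(N)$ the number of vertices within distance $N$ of the initial vertex, exponential growth means $f(N)\ge c^N$ for some $c>1$ and all large $N$. -}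

module Defs where

open import Data.Nat as ℕ using (ℕ; zero; suc)
open import Data.Integer as ℤ using (ℤ; +_; -[1+_])
open import Data.Fin using (Fin; zero; suc)
open import Data.Fin.Permutation using (Permutation′; _⟨$⟩ʳ_)
open import Data.Vec as Vec using (Vec)
open import Data.Vec.Properties using (≡-dec)
open import Data.List as List using (List; []; _∷_; _++_; length)
open import Data.List.Relation.Unary.All using (All)
open import Data.List.Relation.Unary.Any using (Any)
open import Data.List.Relation.Unary.AllPairs using (AllPairs)
open import Data.Product using (Σ; _×_; _,_)
open import Data.Sum using (_⊎_)
open import Relation.Nullary using (¬_; yes; no)
open import Relation.Binary.PropositionalEquality using (_≡_)

Mat : Set
Mat = Fin 6 → Fin 6 → ℤ

[_]₊ : ℤ → ℕ
[ + n ]₊ = n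
[ -[1+ n ] ]₊ = 0

pos : ℤ → ℤ
pos z = + [ z ]₊

-- matrix mutation mu_k:
--  b'_ij = -b_ij if k ∈ {i,j},
--  b'_ij = b_ij + (|b_ik| b_kj + b_ik |b_kj|)/2 otherwise,
-- where (|b_ik| b_kj + b_ik |b_kj|)/2 = [b_ik]_+ [b_kj]_+ - [-b_ik]_+ [-b_kj]_+
-- (written in this division-free form).
matMut : Fin 6 → Mat → Mat
matMut k B i j with i Data.Fin.≟ k | j Data.Fin.≟ k
... | yes _ | _ = ℤ.- B i j
... | no _ | yes _ = ℤ.- B i j
... | no _ | no _ =
  B i j ℤ.+ (pos (B i k) ℤ.* pos (B k j) ℤ.- pos (ℤ.- B i k) ℤ.* pos (ℤ.- B k j))

matMutSeq : List (Fin 6) → Mat → Mat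
matMutSeq [] B = B
matMutSeq (k ∷ ks) B = matMut k (matMutSeq ks B)

-- Vertex labels: c = 0, a1 = 1, b1 = 2, a2 = 3, b2 = 4, e = 5.
-- Arrows c→a_i, a_i⇒b_i (weight 2), b_i→c, c→e.
X6 : Mat
X6 zero (suc zero) = + 1
X6 zero (suc (suc (suc zero))) = + 1
X6 zero (suc (suc (suc (suc (suc zero))))) = + 1
X6 (suc zero) zero = ℤ.- (+ 1)
X6 (suc (suc (suc zero))) zero = ℤ.- (+ 1)
X6 (suc (suc (suc (suc (suc zero))))) zero = ℤ.- (+ 1)
X6 (suc zero) (suc (suc zero)) = + 2
X6 (suc (suc zero)) (suc zero) = ℤ.- (+ 2)
X6 (suc (suc (suc zero))) (suc (suc (suc (suc zero)))) = + 2
X6 (suc (suc (suc (suc zero)))) (suc (suc (suc zero))) = ℤ.- (+ 2)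
X6 (suc (suc zero)) zero = + 1
X6 zero (suc (suc zero)) = ℤ.- (+ 1)
X6 (suc (suc (suc (suc zero)))) zero = + 1
X6 zero (suc (suc (suc (suc zero)))) = ℤ.- (+ 1)
X6 _ _ = + 0

opp : Mat → Mat
opp B i j = ℤ.- B i j

TypeX6 : Mat → Set
TypeX6 B = Σ (List (Fin 6)) λ ks → Σ (Permutation′ 6) λ σ →
  ((∀ i j → B i j ≡ matMutSeq ks X6 (σ ⟨$⟩ʳ i) (σ ⟨$⟩ʳ j))
   ⊎ (∀ i j → B i j ≡ matMutSeq ks (opp X6) (σ ⟨$⟩ʳ i) (σ ⟨$⟩ʳ j)))

-- Polynomials in x_1..x_6 with integer coefficients: a formal sum
-- (list) of terms c·x^e, with e an exponent vector.

Mono : Set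
Mono = Vec ℕ 6

Poly : Set
Poly = List (ℤ × Mono)

coeff : Poly → Mono → ℤ
coeff [] m = + 0
coeff ((c , e) ∷ p) m with ≡-dec ℕ._≟_ e m
... | yes _ = c ℤ.+ coeff p m
... | no _ = coeff p m

_≈P_ : Poly → Poly → Set
p ≈P q = ∀ m → coeff p m ≡ coeff q m

_+P_ : Poly → Poly → Poly
p +P q = p ++ q

_*P_ : Poly → Poly → Poly
p *P q = List.concatMap (λ { (c , e) → List.map (λ { (d , f) → (c ℤ.* d , Vec.zipWith ℕ._+_ e f) }) q }) p

oneP : Poly
oneP = (+ 1 , Vec.replicate 6 0) ∷ []

varP : Fin 6 → Poly
varP i = (+ 1 , Vec.tabulate (λ j → onehot j)) ∷ []
  where
  onehot : Fin 6 → ℕ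
  onehot j with j Data.Fin.≟ i
  ... | yes _ = 1
  ... | no _ = 0

record Frac : Set where
  constructor _/_
  field
    num : Poly
    den : Poly
open Frac public

_≈F_ : Frac → Frac → Set
(a / b) ≈F (c / d) = (a *P d) ≈P (c *P b)

_+F_ : Frac → Frac → Frac
(a / b) +F (c / d) = ((a *P d) +P (c *P b)) / (b *P d)

_*F_ : Frac → Frac → Frac
(a / b) *F (c / d) = (a *P c) / (b *P d)

_÷F_ : Frac → Frac → Frac
(a / b) ÷F (c / d) = (a *P d) / (b *P c)

oneF : Frac
oneF = oneP / oneP

_^F_ : Frac → ℕ → Frac
x ^F zero = oneF
x ^F suc n = x *F (x ^F n)

prodF : List Frac → Frac
prodF = List.foldr _*F_ oneF

Cluster : Set
Cluster = Fin 6 → Frac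

record Seed : Set where
  constructor seed
  field
    cl : Cluster
    mat : Mat
open Seed public

allFin6 : List (Fin 6)
allFin6 = List.allFin 6

seedMut : Fin 6 → Seed → Seed
seedMut k (seed x B) = seed x' (matMut k B)
  where
  new : Frac
  new = (prodF (List.map (λ i → x i ^F [ B i k ]₊) allFin6)
         +F prodF (List.map (λ i → x i ^F [ ℤ.- B i k ]₊) allFin6)) ÷F x k
  x' : Cluster
  x' j with j Data.Fin.≟ k
  ... | yes _ = new
  ... | no _ = x j

initSeed : Mat → Seed
initSeed B = seed (λ i → varP i / oneP) B

-- vertices of the 6-regular tree are mutation sequences; the list
-- k ∷ ks denotes: first apply ks, then mutate at k.
seedAt : Mat → List (Fin 6) → Seed
seedAt B [] = initSeed B
seedAt B (k ∷ ks) = seedMut k (seedAt B ks)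

SameCluster : Cluster → Cluster → Set
SameCluster x y = (∀ i → Σ (Fin 6) λ j → x i ≈F y j)
                × (∀ j → Σ (Fin 6) λ i → y j ≈F x i)

-- tree vertices s,t are identified in the exchange graph
Same : Mat → List (Fin 6) → List (Fin 6) → Set
Same B s t = SameCluster (cl (seedAt B s)) (cl (seedAt B t))

-- Within N B s : the exchange-graph vertex of tree vertex s lies at
-- distance ≤ N from the initial vertex (distance in the quotient graph,
-- whose edges are images of tree edges t — k ∷ t).
Within : Mat → ℕ → List (Fin 6) → Set
Within B zero s = Same B s []
Within B (suc N) s = Within B N s
  ⊎ (Σ (List (Fin 6)) λ u → Σ (List (Fin 6)) λ t → Σ (Fin 6) λ k →
       Within B N u × Same B u t × Same B (k ∷ t) s)

-- f(N) ≥ L : there are L pairwise distinct exchange-graph vertices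
-- within distance N of the initial vertex.
AtLeast : Mat → ℕ → ℕ → Set
AtLeast B N L = Σ (List (List (Fin 6))) λ vs →
  L ℕ.≤ length vs × All (Within B N) vs × AllPairs (λ u v → ¬ Same B u v) vs

-- exponential growth: f(N) ≥ c^N for all large N, for some c > 1;
-- c taken rational c = p/q (equivalent to real c > 1), so f(N)·q^N ≥ p^N.
ExpGrowth : Mat → Set
ExpGrowth B = Σ ℕ λ p → Σ ℕ λ q → (1 ℕ.≤ q) × (q ℕ.< p) × (Σ ℕ λ N₀ → ∀ N → N₀ ℕ.≤ N →
  Σ ℕ λ L → AtLeast B N L × (p ℕ.^ N ℕ.≤ L ℕ.* q ℕ.^ N))

-- Give x_i the weight w_i and send a subtraction-free rational function to the maximal weighted
-- degree of its numerator minus that of its denominator.  This valuation turns products into sums and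
-- sums into maxima, so it carries seed mutation to tropical mutation
-- x_k ↦ max (Σ [b_ik]₊ x_i , Σ [-b_ik]₊ x_i) - x_k, and seeds with the same cluster have the same set
-- of tropical values.
--
-- X6 has two mutation cycles g and h of length 8 that return X6 to itself and move a two-parameter
-- family of tropical points by (p , q) ↦ (p , 2p + q + 2) and (p , q) ↦ (p + 2q + 1 , q).  Both maps
-- are injective, the first lands in p < q, the second in q < p and the start (0 , 0) in neither, so a
-- word in g and h is determined by its endpoint; and the value set of a family point determines
-- (p , q).  Hence the 2^n words of length n lead to 2^n distinct clusters at distance ≤ 8n + const,
-- and as (24/23)^16 < 2 this gives f(N) ≥ (24/23)^N.  A matrix of type X6 arises from ±X6 by a mutation
-- sequence and a relabelling, and tropical mutation is compatible with relabelling, blind to the sign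
-- of B, and undone by mutating back, so the construction transports to B.

module Submission where

open import Defs
open import Function using (_∘_)
open import Data.Nat as ℕ using (ℕ; zero; suc)
import Data.Nat.Properties as ℕP
open import Data.Integer as ℤ using (ℤ; +_)
import Data.Integer.Properties as ℤP
open import Algebra.Properties.CommutativeMonoid.Sum ℤP.+-0-commutativeMonoid using (sum; sum-cong-≗; sum-permute)
open import Data.Fin as Fin using (Fin; zero; suc)
open import Data.Fin.Patterns using (0F; 1F; 2F; 3F; 4F; 5F)
open import Data.Fin.Properties using (all?)
open import Data.Fin.Permutation as Perm using (Permutation′; _⟨$⟩ʳ_; _⟨$⟩ˡ_)
open import Data.Vec as Vec using (Vec; []; _∷_)
open import Data.List as List using (List; []; _∷_; _++_; length)
import Data.List.Properties as List
open import Data.List.Relation.Unary.All as All using (All; []; _∷_)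
import Data.List.Relation.Unary.All.Properties as All
open import Data.List.Relation.Unary.AllPairs as AllPairs using (AllPairs; []; _∷_)
import Data.List.Relation.Unary.AllPairs.Properties as AllPairs
open import Data.Product using (Σ; _×_; _,_; proj₁; proj₂)
open import Data.Sum using (_⊎_; inj₁; inj₂)
open import Data.Unit using (⊤; tt)
open import Data.Empty using (⊥-elim)
open import Relation.Nullary using (¬_; yes; no; Dec)
open import Relation.Nullary.Decidable using (_×-dec_; _⊎-dec_; map′; from-yes)
open import Relation.Binary.PropositionalEquality

module Valuation where

  open import Data.Nat using (z≤n; s≤s)
  open import Data.Integer using (_+_; _-_; -_; _*_; _⊔_; _≤_; _<_; +<+)
  open import Data.Integer.Tactic.RingSolver using (solve-∀)
  open import Data.Vec.Properties using (≡-dec)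

  degree : ∀ {n} → (Fin n → ℤ) → Vec ℕ n → ℤ
  degree w []       = + 0
  degree w (e ∷ es) = w zero * + e + degree (w ∘ suc) es

  degree-zipWith : ∀ {n} (w : Fin n → ℤ) (e f : Vec ℕ n) →
                   degree w (Vec.zipWith ℕ._+_ e f) ≡ degree w e + degree w f
  degree-zipWith w []      []      = refl
  degree-zipWith w (a ∷ e) (b ∷ f) =
    trans (cong₂ (λ x y → w zero * x + y) (ℤP.pos-+ a b) (degree-zipWith (w ∘ suc) e f))
          (distrib (w zero) (+ a) (+ b) _ _)
    where
    distrib : ∀ x a b d e → x * (a + b) + (d + e) ≡ (x * a + d) + (x * b + e)
    distrib = solve-∀

  degree-replicate-0 : ∀ {n} (w : Fin n → ℤ) → degree w (Vec.replicate n 0) ≡ + 0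
  degree-replicate-0 {zero}  w = refl
  degree-replicate-0 {suc n} w =
    trans (cong₂ _+_ (ℤP.*-zeroʳ (w zero)) (degree-replicate-0 (w ∘ suc))) refl

  indicator : ∀ {n} → Fin n → Vec ℕ n
  indicator zero    = 1 ∷ Vec.replicate _ 0
  indicator (suc i) = 0 ∷ indicator i

  degree-indicator : ∀ {n} (w : Fin n → ℤ) i → degree w (indicator i) ≡ w i
  degree-indicator w zero    =
    trans (cong₂ _+_ (ℤP.*-identityʳ (w zero)) (degree-replicate-0 (w ∘ suc))) (ℤP.+-identityʳ (w zero))
  degree-indicator w (suc i) =
    trans (cong₂ _+_ (ℤP.*-zeroʳ (w zero)) (degree-indicator (w ∘ suc) i)) (ℤP.+-identityˡ (w (suc i)))

  varP-indicator : ∀ i → varP i ≡ (+ 1 , indicator i) ∷ []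
  varP-indicator zero                               = refl
  varP-indicator (suc zero)                         = refl
  varP-indicator (suc (suc zero))                   = refl
  varP-indicator (suc (suc (suc zero)))             = refl
  varP-indicator (suc (suc (suc (suc zero))))       = refl
  varP-indicator (suc (suc (suc (suc (suc zero))))) = refl

  -- The value on [] is junk: the lemmas below assume NonEmpty.
  leading : (Fin 6 → ℤ) → Poly → ℤ
  leading w []                = + 0
  leading w ((_ , e) ∷ [])    = degree w e
  leading w ((_ , e) ∷ t ∷ p) = degree w e ⊔ leading w (t ∷ p)

  data NonEmpty {A : Set} : List A → Set where
    nonEmpty : ∀ {x xs} → NonEmpty (x ∷ xs)

  PositiveCoeffs : Poly → Set
  PositiveCoeffs = All (λ t → + 0 < proj₁ t)

  PositivePoly : Poly → Set
  PositivePoly p = NonEmpty p × PositiveCoeffs p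

  term* : ℤ × Mono → ℤ × Mono → ℤ × Mono
  term* (c , e) (d , f) = (c * d , Vec.zipWith ℕ._+_ e f)

  nonEmpty-++ : ∀ {A : Set} {p : List A} q → NonEmpty p → NonEmpty (p ++ q)
  nonEmpty-++ q nonEmpty = nonEmpty

  nonEmpty-*P : ∀ p q → NonEmpty p → NonEmpty q → NonEmpty (p *P q)
  nonEmpty-*P ((c , e) ∷ p) (_ ∷ _) nonEmpty nonEmpty = nonEmpty

  *-positive : ∀ {c d} → + 0 < c → + 0 < d → + 0 < c * d
  *-positive (+<+ (s≤s _)) (+<+ (s≤s _)) = +<+ (s≤s z≤n)

  positiveCoeffs-*P : ∀ p q → PositiveCoeffs p → PositiveCoeffs q → PositiveCoeffs (p *P q)
  positiveCoeffs-*P []            q []         _  = []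
  positiveCoeffs-*P ((c , e) ∷ p) q (c>0 ∷ ps) qs =
    All.++⁺ (All.map⁺ (All.map (*-positive c>0) qs)) (positiveCoeffs-*P p q ps qs)

  positivePoly-++ : ∀ {p q} → PositivePoly p → PositivePoly q → PositivePoly (p ++ q)
  positivePoly-++ {q = q} (ne , ps) (_ , qs) = nonEmpty-++ q ne , All.++⁺ ps qs

  positivePoly-*P : ∀ {p q} → PositivePoly p → PositivePoly q → PositivePoly (p *P q)
  positivePoly-*P {p} {q} (np , ps) (nq , qs) = nonEmpty-*P p q np nq , positiveCoeffs-*P p q ps qs

  positivePoly-oneP : PositivePoly oneP
  positivePoly-oneP = nonEmpty , +<+ (s≤s z≤n) ∷ []

  +-distribˡ-⊔ : ∀ a x y → a + (x ⊔ y) ≡ (a + x) ⊔ (a + y)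
  +-distribˡ-⊔ a = ℤP.mono-≤-distrib-⊔ (ℤP.+-monoʳ-≤ a)

  +-distribʳ-⊔ : ∀ a x y → (x ⊔ y) + a ≡ (x + a) ⊔ (y + a)
  +-distribʳ-⊔ a = ℤP.mono-≤-distrib-⊔ (ℤP.+-monoˡ-≤ a)

  module _ (w : Fin 6 → ℤ) where

    leading-++ : ∀ p q → NonEmpty p → NonEmpty q → leading w (p ++ q) ≡ leading w p ⊔ leading w q
    leading-++ ((_ , e) ∷ [])    (_ ∷ _) nonEmpty nonEmpty = refl
    leading-++ ((_ , e) ∷ t ∷ p) q       nonEmpty nq       =
      trans (cong (degree w e ⊔_) (leading-++ (t ∷ p) q nonEmpty nq)) (sym (ℤP.⊔-assoc (degree w e) _ _))

    leading-map-term* : ∀ c e q → NonEmpty q →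
                        leading w (List.map (term* (c , e)) q) ≡ degree w e + leading w q
    leading-map-term* c e ((d , f) ∷ [])    nonEmpty = degree-zipWith w e f
    leading-map-term* c e ((d , f) ∷ t ∷ q) nonEmpty =
      trans (cong₂ _⊔_ (degree-zipWith w e f) (leading-map-term* c e (t ∷ q) nonEmpty))
            (sym (+-distribˡ-⊔ (degree w e) (degree w f) (leading w (t ∷ q))))

    leading-*P : ∀ p q → NonEmpty p → NonEmpty q → leading w (p *P q) ≡ leading w p + leading w q
    leading-*P ((c , e) ∷ [])    q nonEmpty nq =
      trans (cong (leading w) (List.++-identityʳ (List.map (term* (c , e)) q))) (leading-map-term* c e q nq)
    leading-*P ((c , e) ∷ t ∷ p) q nonEmpty nq = begin
      leading w (List.map (term* (c , e)) q ++ ((t ∷ p) *P q))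
        ≡⟨ leading-++ (List.map (term* (c , e)) q) ((t ∷ p) *P q) (nonEmpty-map q nq) (nonEmpty-*P (t ∷ p) q nonEmpty nq) ⟩
      leading w (List.map (term* (c , e)) q) ⊔ leading w ((t ∷ p) *P q)
        ≡⟨ cong₂ _⊔_ (leading-map-term* c e q nq) (leading-*P (t ∷ p) q nonEmpty nq) ⟩
      (degree w e + leading w q) ⊔ (leading w (t ∷ p) + leading w q)
        ≡⟨ sym (+-distribʳ-⊔ (leading w q) (degree w e) (leading w (t ∷ p))) ⟩
      (degree w e ⊔ leading w (t ∷ p)) + leading w q ∎
      where
      open ≡-Reasoning
      nonEmpty-map : ∀ {f : ℤ × Mono → ℤ × Mono} q → NonEmpty q → NonEmpty (List.map f q)
      nonEmpty-map (_ ∷ _) nonEmpty = nonEmpty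

    leading-lub : ∀ p {M} → NonEmpty p → All (λ t → degree w (proj₂ t) ≤ M) p → leading w p ≤ M
    leading-lub ((_ , e) ∷ [])    nonEmpty (le ∷ [])  = le
    leading-lub ((_ , e) ∷ t ∷ p) nonEmpty (le ∷ les) = ℤP.⊔-lub le (leading-lub (t ∷ p) nonEmpty les)

    degree-≤-leading : ∀ q m → coeff q m ≢ + 0 → degree w m ≤ leading w q
    degree-≤-leading [] m nz = ⊥-elim (nz refl)
    degree-≤-leading ((c , e) ∷ q) m nz with ≡-dec ℕ._≟_ e m
    degree-≤-leading ((c , e) ∷ [])    m nz | yes refl = ℤP.≤-refl
    degree-≤-leading ((c , e) ∷ t ∷ q) m nz | yes refl = ℤP.i≤i⊔j _ _
    degree-≤-leading ((c , e) ∷ [])    m nz | no _     = ⊥-elim (nz refl)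
    degree-≤-leading ((c , e) ∷ t ∷ q) m nz | no _     =
      ℤP.≤-trans (degree-≤-leading (t ∷ q) m nz) (ℤP.i≤j⊔i _ _)

  coeff-∷-≥ : ∀ c e p m → + 0 ≤ c → coeff p m ≤ coeff ((c , e) ∷ p) m
  coeff-∷-≥ c e p m c≥0 with ≡-dec ℕ._≟_ e m
  ... | yes _ = ℤP.≤-trans (ℤP.≤-reflexive (sym (ℤP.+-identityˡ (coeff p m)))) (ℤP.+-monoˡ-≤ (coeff p m) c≥0)
  ... | no _  = ℤP.≤-refl

  coeff-nonNegative : ∀ p m → PositiveCoeffs p → + 0 ≤ coeff p m
  coeff-nonNegative []            m []          = ℤP.≤-refl
  coeff-nonNegative ((c , e) ∷ p) m (c>0 ∷ ps) =
    ℤP.≤-trans (coeff-nonNegative p m ps) (coeff-∷-≥ c e p m (ℤP.<⇒≤ c>0))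

  coeff-support : ∀ p → PositiveCoeffs p → All (λ t → + 0 < coeff p (proj₂ t)) p
  coeff-support []            []          = []
  coeff-support ((c , e) ∷ p) (c>0 ∷ ps) =
    head ∷ All.map (λ {t} pos → ℤP.<-≤-trans pos (coeff-∷-≥ c e p (proj₂ t) (ℤP.<⇒≤ c>0))) (coeff-support p ps)
    where
    head : + 0 < coeff ((c , e) ∷ p) e
    head with ≡-dec ℕ._≟_ e e
    ... | yes _ = ℤP.+-mono-<-≤ c>0 (coeff-nonNegative p e ps)
    ... | no e≢e = ⊥-elim (e≢e refl)

  module _ (w : Fin 6 → ℤ) where

    -- Positive coefficients cannot cancel, so every monomial of p survives in q.
    leading-mono-≈P : ∀ p q → PositivePoly p → p ≈P q → leading w p ≤ leading w q
    leading-mono-≈P p q (ne , ps) p≈q = leading-lub w p ne (All.map (λ {t} → bound {t}) (coeff-support p ps))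
      where
      bound : ∀ {t : ℤ × Mono} → + 0 < coeff p (proj₂ t) → degree w (proj₂ t) ≤ leading w q
      bound {_ , m} pos = degree-≤-leading w q m (λ q₀ → ℤP.<⇒≢ pos (sym (trans (p≈q m) q₀)))

    leading-resp-≈P : ∀ p q → PositivePoly p → PositivePoly q → p ≈P q → leading w p ≡ leading w q
    leading-resp-≈P p q pp pq p≈q =
      ℤP.≤-antisym (leading-mono-≈P p q pp p≈q) (leading-mono-≈P q p pq (λ m → sym (p≈q m)))

  PositiveFrac : Frac → Set
  PositiveFrac f = PositivePoly (num f) × PositivePoly (den f)

  positiveFrac-*F : ∀ {f g} → PositiveFrac f → PositiveFrac g → PositiveFrac (f *F g)
  positiveFrac-*F (pa , pb) (pc , pd) = positivePoly-*P pa pc , positivePoly-*P pb pd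

  positiveFrac-÷F : ∀ {f g} → PositiveFrac f → PositiveFrac g → PositiveFrac (f ÷F g)
  positiveFrac-÷F (pa , pb) (pc , pd) = positivePoly-*P pa pd , positivePoly-*P pb pc

  positiveFrac-+F : ∀ {f g} → PositiveFrac f → PositiveFrac g → PositiveFrac (f +F g)
  positiveFrac-+F (pa , pb) (pc , pd) =
    positivePoly-++ (positivePoly-*P pa pd) (positivePoly-*P pc pb) , positivePoly-*P pb pd

  positiveFrac-oneF : PositiveFrac oneF
  positiveFrac-oneF = positivePoly-oneP , positivePoly-oneP

  positiveFrac-^F : ∀ {f} n → PositiveFrac f → PositiveFrac (f ^F n)
  positiveFrac-^F zero    pf = positiveFrac-oneF
  positiveFrac-^F (suc n) pf = positiveFrac-*F pf (positiveFrac-^F n pf)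

  positiveFrac-prodF : ∀ fs → All PositiveFrac fs → PositiveFrac (prodF fs)
  positiveFrac-prodF []       []         = positiveFrac-oneF
  positiveFrac-prodF (f ∷ fs) (pf ∷ pfs) = positiveFrac-*F pf (positiveFrac-prodF fs pfs)

  positiveFrac-var : ∀ i → PositiveFrac (varP i / oneP)
  positiveFrac-var i rewrite varP-indicator i = (nonEmpty , +<+ (s≤s z≤n) ∷ []) , positivePoly-oneP

  module _ (w : Fin 6 → ℤ) where

    val : Frac → ℤ
    val f = leading w (num f) - leading w (den f)

    val-resp-≈F : ∀ {f g} → PositiveFrac f → PositiveFrac g → f ≈F g → val f ≡ val g
    val-resp-≈F {a / b} {c / d} (pa , pb) (pc , pd) eq =
      cross-sub (leading w a) (leading w b) (leading w c) (leading w d) (begin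
        leading w a + leading w d ≡⟨ leading-*P w a d (proj₁ pa) (proj₁ pd) ⟨
        leading w (a *P d)        ≡⟨ leading-resp-≈P w (a *P d) (c *P b) (positivePoly-*P pa pd) (positivePoly-*P pc pb) eq ⟩
        leading w (c *P b)        ≡⟨ leading-*P w c b (proj₁ pc) (proj₁ pb) ⟩
        leading w c + leading w b ∎)
      where
      open ≡-Reasoning
      cross-sub : ∀ a b c d → a + d ≡ c + b → a - b ≡ c - d
      cross-sub a b c d eq = begin
        a - b             ≡⟨ shift a b d ⟩
        (a + d) - (b + d) ≡⟨ cong (λ z → z - (b + d)) eq ⟩
        (c + b) - (b + d) ≡⟨ cancel c b d ⟩
        c - d             ∎
        where
        shift : ∀ a b d → a - b ≡ (a + d) - (b + d)
        shift = solve-∀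
        cancel : ∀ c b d → (c + b) - (b + d) ≡ c - d
        cancel = solve-∀

    val-*F : ∀ {f g} → PositiveFrac f → PositiveFrac g → val (f *F g) ≡ val f + val g
    val-*F {a / b} {c / d} (pa , pb) (pc , pd) =
      trans (cong₂ _-_ (leading-*P w a c (proj₁ pa) (proj₁ pc)) (leading-*P w b d (proj₁ pb) (proj₁ pd)))
            (regroup (leading w a) (leading w c) (leading w b) (leading w d))
      where
      regroup : ∀ a c b d → (a + c) - (b + d) ≡ (a - b) + (c - d)
      regroup = solve-∀

    val-÷F : ∀ {f g} → PositiveFrac f → PositiveFrac g → val (f ÷F g) ≡ val f - val g
    val-÷F {a / b} {c / d} (pa , pb) (pc , pd) =
      trans (cong₂ _-_ (leading-*P w a d (proj₁ pa) (proj₁ pd)) (leading-*P w b c (proj₁ pb) (proj₁ pc)))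
            (regroup (leading w a) (leading w d) (leading w b) (leading w c))
      where
      regroup : ∀ a d b c → (a + d) - (b + c) ≡ (a - b) - (c - d)
      regroup = solve-∀

    val-+F : ∀ {f g} → PositiveFrac f → PositiveFrac g → val (f +F g) ≡ val f ⊔ val g
    val-+F {a / b} {c / d} (pa , pb) (pc , pd) = begin
      leading w ((a *P d) ++ (c *P b)) - leading w (b *P d)
        ≡⟨ cong₂ _-_ (trans (leading-++ w (a *P d) (c *P b) (nonEmpty-*P a d (proj₁ pa) (proj₁ pd))
                                                            (nonEmpty-*P c b (proj₁ pc) (proj₁ pb)))
                            (cong₂ _⊔_ (leading-*P w a d (proj₁ pa) (proj₁ pd)) (leading-*P w c b (proj₁ pc) (proj₁ pb))))
                     (leading-*P w b d (proj₁ pb) (proj₁ pd)) ⟩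
      ((A + D) ⊔ (C + B)) - (B + D)
        ≡⟨ +-distribʳ-⊔ (- (B + D)) (A + D) (C + B) ⟩
      ((A + D) - (B + D)) ⊔ ((C + B) - (B + D))
        ≡⟨ cong₂ _⊔_ (cancelʳ A D B) (cancelˡ C B D) ⟩
      (A - B) ⊔ (C - D) ∎
      where
      open ≡-Reasoning
      A = leading w a
      B = leading w b
      C = leading w c
      D = leading w d
      cancelʳ : ∀ A D B → (A + D) - (B + D) ≡ A - B
      cancelʳ = solve-∀
      cancelˡ : ∀ C B D → (C + B) - (B + D) ≡ C - D
      cancelˡ = solve-∀

    val-oneF : val oneF ≡ + 0
    val-oneF = ℤP.+-inverseʳ (degree w (Vec.replicate 6 0))

    val-^F : ∀ {f} n → PositiveFrac f → val (f ^F n) ≡ + n * val f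
    val-^F {f} zero    pf = trans val-oneF (sym (ℤP.*-zeroˡ (val f)))
    val-^F {f} (suc n) pf =
      trans (val-*F pf (positiveFrac-^F n pf))
            (trans (cong (_+_ (val f)) (val-^F n pf)) (suc-* (+ n) (val f)))
      where
      suc-* : ∀ n v → v + n * v ≡ (+ 1 + n) * v
      suc-* = solve-∀

    val-prodF : ∀ fs → All PositiveFrac fs → val (prodF fs) ≡ List.foldr (λ f acc → val f + acc) (+ 0) fs
    val-prodF []       []         = val-oneF
    val-prodF (f ∷ fs) (pf ∷ pfs) =
      trans (val-*F pf (positiveFrac-prodF fs pfs)) (cong (_+_ (val f)) (val-prodF fs pfs))

    val-var : ∀ i → val (varP i / oneP) ≡ w i
    val-var i = trans (cong₂ _-_ (trans (cong (leading w) (varP-indicator i)) (degree-indicator w i))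
                                 (degree-replicate-0 w))
                      (ℤP.+-identityʳ (w i))

open Valuation

module Tropicalisation where

  open import Data.Integer using (_-_; -_; _*_; _⊔_)

  _≗₂_ : Mat → Mat → Set
  B ≗₂ C = ∀ i j → B i j ≡ C i j

  tropMonomial⁺ tropMonomial⁻ : Fin 6 → Mat → (Fin 6 → ℤ) → ℤ
  tropMonomial⁺ k B x = sum (λ i → + [ B i k ]₊ * x i)
  tropMonomial⁻ k B x = sum (λ i → + [ - B i k ]₊ * x i)

  tropMut : Fin 6 → Mat → (Fin 6 → ℤ) → (Fin 6 → ℤ)
  tropMut k B x j with j Fin.≟ k
  ... | yes _ = (tropMonomial⁺ k B x ⊔ tropMonomial⁻ k B x) - x k
  ... | no _  = x j

  tropMutSeq : Mat → List (Fin 6) → (Fin 6 → ℤ) → (Fin 6 → ℤ)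
  tropMutSeq B []       x = x
  tropMutSeq B (k ∷ ks) x = tropMut k (matMutSeq ks B) (tropMutSeq B ks x)

  tropMut-cong : ∀ k {B C x y} → B ≗₂ C → x ≗ y → tropMut k B x ≗ tropMut k C y
  tropMut-cong k B≗C x≗y j with j Fin.≟ k
  ... | yes _ = cong₂ _-_ (cong₂ _⊔_ (sum-cong-≗ (λ i → cong₂ (λ b z → + [ b ]₊ * z) (B≗C i k) (x≗y i)))
                                      (sum-cong-≗ (λ i → cong₂ (λ b z → + [ - b ]₊ * z) (B≗C i k) (x≗y i))))
                          (x≗y k)
  ... | no _  = x≗y j

  mat-seedAt : ∀ B s → mat (seedAt B s) ≡ matMutSeq s B
  mat-seedAt B []      = refl
  mat-seedAt B (k ∷ s) = cong (matMut k) (mat-seedAt B s)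

  PositiveCluster : Cluster → Set
  PositiveCluster x = ∀ i → PositiveFrac (x i)

  module _ (k : Fin 6) (x : Cluster) (B : Mat) (px : PositiveCluster x) where

    private
      e⁺ e⁻ : Fin 6 → ℕ
      e⁺ i = [ B i k ]₊
      e⁻ i = [ - B i k ]₊

      monomial⁺ monomial⁻ : Frac
      monomial⁺ = prodF (List.map (λ i → x i ^F e⁺ i) allFin6)
      monomial⁻ = prodF (List.map (λ i → x i ^F e⁻ i) allFin6)

      positive-monomial : ∀ (e : Fin 6 → ℕ) → PositiveFrac (prodF (List.map (λ i → x i ^F e i) allFin6))
      positive-monomial e = positiveFrac-prodF _ (All.tabulate⁺ (λ i → positiveFrac-^F (e i) (px i)))

      positive-exchange : PositiveFrac (monomial⁺ +F monomial⁻)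
      positive-exchange = positiveFrac-+F (positive-monomial e⁺) (positive-monomial e⁻)

    positive-seedMut : PositiveCluster (cl (seedMut k (seed x B)))
    positive-seedMut j with j Fin.≟ k
    ... | yes _ = positiveFrac-÷F positive-exchange (px k)
    ... | no _  = px j

    module _ (w : Fin 6 → ℤ) where

      private
        val-monomial : ∀ (e : Fin 6 → ℕ) →
                       val w (prodF (List.map (λ i → x i ^F e i) allFin6)) ≡ sum (λ i → + e i * val w (x i))
        val-monomial e = trans (val-prodF w _ (All.tabulate⁺ (λ i → positiveFrac-^F (e i) (px i))))
                               (sum-cong-≗ (λ i → val-^F w (e i) (px i)))

      val-seedMut : ∀ j → val w (cl (seedMut k (seed x B)) j) ≡ tropMut k B (val w ∘ x) j
      val-seedMut j with j Fin.≟ k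
      ... | yes _ = trans (val-÷F w positive-exchange (px k))
                          (cong (_- val w (x k)) (trans (val-+F w (positive-monomial e⁺) (positive-monomial e⁻))
                                                        (cong₂ _⊔_ (val-monomial e⁺) (val-monomial e⁻))))
      ... | no _  = refl

  positive-seedAt : ∀ B s → PositiveCluster (cl (seedAt B s))
  positive-seedAt B []      i = positiveFrac-var i
  positive-seedAt B (k ∷ s)   = positive-seedMut k _ _ (positive-seedAt B s)

  val-seedAt : ∀ (w : Fin 6 → ℤ) B s → val w ∘ cl (seedAt B s) ≗ tropMutSeq B s w
  val-seedAt w B []      j = val-var w j
  val-seedAt w B (k ∷ s) j =
    trans (val-seedMut k _ _ (positive-seedAt B s) w j)
          (tropMut-cong k (λ a b → cong (λ M → M a b) (mat-seedAt B s)) (val-seedAt w B s) j)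

  SameValues : (Fin 6 → ℤ) → (Fin 6 → ℤ) → Set
  SameValues x y = (∀ i → Σ (Fin 6) λ j → x i ≡ y j) × (∀ j → Σ (Fin 6) λ i → y j ≡ x i)

  same⇒sameValues : ∀ w B s t → Same B s t → SameValues (tropMutSeq B s w) (tropMutSeq B t w)
  same⇒sameValues w B s t (s⊆t , t⊆s) = transport s t s⊆t , transport t s t⊆s
    where
    transport : ∀ s t → (∀ i → Σ (Fin 6) λ j → cl (seedAt B s) i ≈F cl (seedAt B t) j) →
                ∀ i → Σ (Fin 6) λ j → tropMutSeq B s w i ≡ tropMutSeq B t w j
    transport s t h i with h i
    ... | j , eq = j , trans (sym (val-seedAt w B s i))
                             (trans (val-resp-≈F w (positive-seedAt B s i) (positive-seedAt B t j) eq)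
                                    (val-seedAt w B t j))

  sameValues-cong : ∀ {x x′ y y′} → x ≗ x′ → y ≗ y′ → SameValues x y → SameValues x′ y′
  sameValues-cong x≗ y≗ (x⊆y , y⊆x) =
    (λ i → proj₁ (x⊆y i) , trans (sym (x≗ i)) (trans (proj₂ (x⊆y i)) (y≗ _))) ,
    (λ j → proj₁ (y⊆x j) , trans (sym (y≗ j)) (trans (proj₂ (y⊆x j)) (x≗ _)))

  sameValues-permute : ∀ (σ : Permutation′ 6) {x y} → SameValues (x ∘ (σ ⟨$⟩ʳ_)) (y ∘ (σ ⟨$⟩ʳ_)) → SameValues x y
  sameValues-permute σ (x⊆y , y⊆x) = transport x⊆y , transport y⊆x
    where
    transport : ∀ {x y : Fin 6 → ℤ} → (∀ i → Σ (Fin 6) λ j → x (σ ⟨$⟩ʳ i) ≡ y (σ ⟨$⟩ʳ j)) →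
                ∀ i → Σ (Fin 6) λ j → x i ≡ y j
    transport {x} h i with h (σ ⟨$⟩ˡ i)
    ... | j , eq = σ ⟨$⟩ʳ j , trans (cong x (sym (Perm.inverseʳ σ))) eq

open Tropicalisation

module MutationSymmetries where

  open import Data.Integer using (-[1+_]; _+_; _-_; -_; _*_; _⊔_)
  open import Data.Integer.Tactic.RingSolver using (solve-∀)

  exchange : Mat → Fin 6 → Fin 6 → Fin 6 → ℤ
  exchange B k i j = pos (B i k) * pos (B k j) - pos (- B i k) * pos (- B k j)

  matMut-≡ˡ : ∀ k B i j → i ≡ k → matMut k B i j ≡ - B i j
  matMut-≡ˡ k B i j i≡k with i Fin.≟ k
  ... | yes _  = refl
  ... | no i≢k = ⊥-elim (i≢k i≡k)

  matMut-≡ʳ : ∀ k B i j → j ≡ k → matMut k B i j ≡ - B i j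
  matMut-≡ʳ k B i j j≡k with i Fin.≟ k | j Fin.≟ k
  ... | yes _ | _      = refl
  ... | no _  | yes _  = refl
  ... | no _  | no j≢k = ⊥-elim (j≢k j≡k)

  matMut-≢ : ∀ k B i j → i ≢ k → j ≢ k → matMut k B i j ≡ B i j + exchange B k i j
  matMut-≢ k B i j i≢k j≢k with i Fin.≟ k | j Fin.≟ k
  ... | yes i≡k | _       = ⊥-elim (i≢k i≡k)
  ... | no _    | yes j≡k = ⊥-elim (j≢k j≡k)
  ... | no _    | no _    = refl

  matMut-cong : ∀ k {B C} → B ≗₂ C → matMut k B ≗₂ matMut k C
  matMut-cong k {B} {C} B≗C i j with i Fin.≟ k | j Fin.≟ k
  ... | yes _ | _     = cong -_ (B≗C i j)
  ... | no _  | yes _ = cong -_ (B≗C i j)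
  ... | no _  | no _  = cong₂ _+_ (B≗C i j) (cong₂ _-_ (cong₂ (λ a b → pos a * pos b) (B≗C i k) (B≗C k j))
                                                      (cong₂ (λ a b → pos (- a) * pos (- b)) (B≗C i k) (B≗C k j)))

  matMutSeq-cong : ∀ ks {B C} → B ≗₂ C → matMutSeq ks B ≗₂ matMutSeq ks C
  matMutSeq-cong []       B≗C = B≗C
  matMutSeq-cong (k ∷ ks) B≗C = matMut-cong k (matMutSeq-cong ks B≗C)

  matMutSeq-++ : ∀ ks ls B → matMutSeq (ks ++ ls) B ≡ matMutSeq ks (matMutSeq ls B)
  matMutSeq-++ []       ls B = refl
  matMutSeq-++ (k ∷ ks) ls B = cong (matMut k) (matMutSeq-++ ks ls B)

  tropMut-≡ : ∀ k B x → tropMut k B x k ≡ (tropMonomial⁺ k B x ⊔ tropMonomial⁻ k B x) - x k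
  tropMut-≡ k B x with k Fin.≟ k
  ... | yes _  = refl
  ... | no k≢k = ⊥-elim (k≢k refl)

  tropMut-≢ : ∀ k B x j → j ≢ k → tropMut k B x j ≡ x j
  tropMut-≢ k B x j j≢k with j Fin.≟ k
  ... | yes j≡k = ⊥-elim (j≢k j≡k)
  ... | no _    = refl

  tropMutSeq-cong : ∀ ks {B C x y} → B ≗₂ C → x ≗ y → tropMutSeq B ks x ≗ tropMutSeq C ks y
  tropMutSeq-cong []       B≗C x≗y = x≗y
  tropMutSeq-cong (k ∷ ks) B≗C x≗y = tropMut-cong k (matMutSeq-cong ks B≗C) (tropMutSeq-cong ks B≗C x≗y)

  tropMutSeq-++ : ∀ ks ls B x → tropMutSeq B (ks ++ ls) x ≗ tropMutSeq (matMutSeq ls B) ks (tropMutSeq B ls x)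
  tropMutSeq-++ []       ls B x j = refl
  tropMutSeq-++ (k ∷ ks) ls B x   =
    tropMut-cong k (λ a b → cong (λ M → M a b) (matMutSeq-++ ks ls B)) (tropMutSeq-++ ks ls B x)

  Skew : Mat → Set
  Skew B = ∀ i j → B j i ≡ - B i j

  skew-diagonal : ∀ {B} → Skew B → ∀ k → B k k ≡ + 0
  skew-diagonal {B} skew k = self-negating (B k k) (skew k k)
    where
    self-negating : ∀ z → z ≡ - z → z ≡ + 0
    self-negating (+ zero)  _  = refl
    self-negating (+ suc n) ()
    self-negating -[1+ n ]  ()

  exchange-negated : ∀ {B C} k i j → C i k ≡ - B i k → C k j ≡ - B k j → exchange C k i j ≡ - exchange B k i j
  exchange-negated {B} k i j eq₁ eq₂
    rewrite eq₁ | eq₂ | ℤP.neg-involutive (B i k) | ℤP.neg-involutive (B k j) =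
    swap (pos (B i k) * pos (B k j)) (pos (- B i k) * pos (- B k j))
    where
    swap : ∀ p q → q - p ≡ - (p - q)
    swap = solve-∀

  exchange-transpose : ∀ {B} → Skew B → ∀ k i j → exchange B k j i ≡ - exchange B k i j
  exchange-transpose {B} skew k i j
    rewrite skew k j | skew i k | ℤP.neg-involutive (B k j) | ℤP.neg-involutive (B i k) =
    swap (pos (B i k)) (pos (B k j)) (pos (- B i k)) (pos (- B k j))
    where
    swap : ∀ p₁ p₂ n₁ n₂ → n₂ * n₁ - p₂ * p₁ ≡ - (p₁ * p₂ - n₁ * n₂)
    swap = solve-∀

  skew-matMut : ∀ k {B} → Skew B → Skew (matMut k B)
  skew-matMut k {B} skew i j with i Fin.≟ k | j Fin.≟ k
  ... | yes _ | yes _ = cong -_ (skew i j)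
  ... | yes _ | no _  = cong -_ (skew i j)
  ... | no _  | yes _ = cong -_ (skew i j)
  ... | no _  | no _  =
    trans (cong₂ _+_ (skew i j) (exchange-transpose skew k i j)) (sym (ℤP.neg-distrib-+ (B i j) (exchange B k i j)))

  skew-opp : ∀ {B} → Skew B → Skew (opp B)
  skew-opp skew i j = cong -_ (skew i j)

  skew-matMutSeq : ∀ ks {B} → Skew B → Skew (matMutSeq ks B)
  skew-matMutSeq []       skew = skew
  skew-matMutSeq (k ∷ ks) skew = skew-matMut k (skew-matMutSeq ks skew)

  matMut-involutive : ∀ k B → matMut k (matMut k B) ≗₂ B
  matMut-involutive k B i j = cases (i Fin.≟ k) (j Fin.≟ k)
    where
    open ≡-Reasoning
    negate-twice : ∀ {z} → z ≡ - B i j → - z ≡ B i j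
    negate-twice eq = trans (cong -_ eq) (ℤP.neg-involutive (B i j))
    cases : Dec (i ≡ k) → Dec (j ≡ k) → matMut k (matMut k B) i j ≡ B i j
    cases (yes i≡k) _         = trans (matMut-≡ˡ k _ i j i≡k) (negate-twice (matMut-≡ˡ k B i j i≡k))
    cases (no _)    (yes j≡k) = trans (matMut-≡ʳ k _ i j j≡k) (negate-twice (matMut-≡ʳ k B i j j≡k))
    cases (no i≢k)  (no j≢k)  = begin
      matMut k (matMut k B) i j                        ≡⟨ matMut-≢ k _ i j i≢k j≢k ⟩
      matMut k B i j + exchange (matMut k B) k i j     ≡⟨ cong₂ _+_ (matMut-≢ k B i j i≢k j≢k) exchange-flips ⟩
      (B i j + exchange B k i j) + - exchange B k i j  ≡⟨ cancel (B i j) (exchange B k i j) ⟩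
      B i j                                            ∎
      where
      exchange-flips : exchange (matMut k B) k i j ≡ - exchange B k i j
      exchange-flips = exchange-negated {B} {matMut k B} k i j (matMut-≡ʳ k B i k refl) (matMut-≡ˡ k B k j refl)
      cancel : ∀ b e → (b + e) + - e ≡ b
      cancel = solve-∀

  tropMonomial-off-pivot : ∀ (c : Fin 6 → ℤ) k {x y : Fin 6 → ℤ} → c k ≡ + 0 → (∀ i → i ≢ k → x i ≡ y i) →
                           sum (λ i → + [ c i ]₊ * x i) ≡ sum (λ i → + [ c i ]₊ * y i)
  tropMonomial-off-pivot c k {x} {y} ck≡0 agree = sum-cong-≗ term
    where
    term : ∀ i → + [ c i ]₊ * x i ≡ + [ c i ]₊ * y i
    term i with i Fin.≟ k
    ... | yes refl = trans (cong (λ z → + [ z ]₊ * x k) ck≡0) (cong (λ z → + [ z ]₊ * y k) (sym ck≡0))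
    ... | no i≢k   = cong (+ [ c i ]₊ *_) (agree i i≢k)

  tropMut-involutive : ∀ k {B} → Skew B → ∀ x → tropMut k (matMut k B) (tropMut k B x) ≗ x
  tropMut-involutive k {B} skew x j = cases (j Fin.≟ k)
    where
    open ≡-Reasoning
    y  = tropMut k B x
    M⁺ = tropMonomial⁺ k B x
    M⁻ = tropMonomial⁻ k B x
    off-pivot : ∀ i → i ≢ k → y i ≡ x i
    off-pivot = tropMut-≢ k B x
    swap⁺ : tropMonomial⁺ k (matMut k B) y ≡ M⁻
    swap⁺ = trans (sum-cong-≗ (λ i → cong (λ b → + [ b ]₊ * y i) (matMut-≡ʳ k B i k refl)))
                  (tropMonomial-off-pivot (λ i → - B i k) k (cong -_ (skew-diagonal skew k)) off-pivot)
    swap⁻ : tropMonomial⁻ k (matMut k B) y ≡ M⁺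
    swap⁻ = trans (sum-cong-≗ (λ i → cong (λ b → + [ - b ]₊ * y i) (matMut-≡ʳ k B i k refl)))
            (trans (sum-cong-≗ (λ i → cong (λ b → + [ b ]₊ * y i) (ℤP.neg-involutive (B i k))))
                   (tropMonomial-off-pivot (λ i → B i k) k (skew-diagonal skew k) off-pivot))
    cancel : ∀ m z → m - (m - z) ≡ z
    cancel = solve-∀
    cases : Dec (j ≡ k) → tropMut k (matMut k B) y j ≡ x j
    cases (no j≢k)  = trans (tropMut-≢ k _ _ j j≢k) (tropMut-≢ k B x j j≢k)
    cases (yes refl) = begin
      tropMut k (matMut k B) y k
        ≡⟨ tropMut-≡ k (matMut k B) y ⟩
      (tropMonomial⁺ k (matMut k B) y ⊔ tropMonomial⁻ k (matMut k B) y) - y k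
        ≡⟨ cong₂ (λ a b → (a ⊔ b) - y k) swap⁺ swap⁻ ⟩
      (M⁻ ⊔ M⁺) - y k
        ≡⟨ cong₂ _-_ (ℤP.⊔-comm M⁻ M⁺) (tropMut-≡ k B x) ⟩
      (M⁺ ⊔ M⁻) - ((M⁺ ⊔ M⁻) - x k)
        ≡⟨ cancel (M⁺ ⊔ M⁻) (x k) ⟩
      x k ∎

  matMutSeq-reverse : ∀ ks B → matMutSeq (List.reverse ks) (matMutSeq ks B) ≗₂ B
  matMutSeq-reverse []       B i j = refl
  matMutSeq-reverse (k ∷ ks) B i j = begin
    matMutSeq (List.reverse (k ∷ ks)) M i j
      ≡⟨ cong (λ ls → matMutSeq ls M i j) (List.unfold-reverse k ks) ⟩
    matMutSeq (List.reverse ks ++ k ∷ []) M i j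
      ≡⟨ cong (λ N → N i j) (matMutSeq-++ (List.reverse ks) (k ∷ []) M) ⟩
    matMutSeq (List.reverse ks) (matMut k M) i j
      ≡⟨ matMutSeq-cong (List.reverse ks) (matMut-involutive k _) i j ⟩
    matMutSeq (List.reverse ks) (matMutSeq ks B) i j
      ≡⟨ matMutSeq-reverse ks B i j ⟩
    B i j ∎
    where
    open ≡-Reasoning
    M = matMut k (matMutSeq ks B)

  tropMutSeq-reverse : ∀ ks {B} → Skew B → ∀ x →
                       tropMutSeq (matMutSeq ks B) (List.reverse ks) (tropMutSeq B ks x) ≗ x
  tropMutSeq-reverse []       skew x j = refl
  tropMutSeq-reverse (k ∷ ks) {B} skew x j = begin
    tropMutSeq M (List.reverse (k ∷ ks)) y j
      ≡⟨ cong (λ ls → tropMutSeq M ls y j) (List.unfold-reverse k ks) ⟩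
    tropMutSeq M (List.reverse ks ++ k ∷ []) y j
      ≡⟨ tropMutSeq-++ (List.reverse ks) (k ∷ []) M y j ⟩
    tropMutSeq (matMut k M) (List.reverse ks) (tropMut k M y) j
      ≡⟨ tropMutSeq-cong (List.reverse ks) (matMut-involutive k _) (tropMut-involutive k (skew-matMutSeq ks skew) _) j ⟩
    tropMutSeq (matMutSeq ks B) (List.reverse ks) (tropMutSeq B ks x) j
      ≡⟨ tropMutSeq-reverse ks skew x j ⟩
    x j ∎
    where
    open ≡-Reasoning
    M = matMut k (matMutSeq ks B)
    y = tropMut k (matMutSeq ks B) (tropMutSeq B ks x)

  matMut-opp : ∀ k B → matMut k (opp B) ≗₂ opp (matMut k B)
  matMut-opp k B i j = cases (i Fin.≟ k) (j Fin.≟ k)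
    where
    cases : Dec (i ≡ k) → Dec (j ≡ k) → matMut k (opp B) i j ≡ - matMut k B i j
    cases (yes i≡k) _         = trans (matMut-≡ˡ k _ i j i≡k) (cong -_ (sym (matMut-≡ˡ k B i j i≡k)))
    cases (no _)    (yes j≡k) = trans (matMut-≡ʳ k _ i j j≡k) (cong -_ (sym (matMut-≡ʳ k B i j j≡k)))
    cases (no i≢k)  (no j≢k)  =
      trans (matMut-≢ k _ i j i≢k j≢k)
            (trans (cong (_+_ (- B i j)) (exchange-negated {B} {opp B} k i j refl refl))
                   (trans (sym (ℤP.neg-distrib-+ (B i j) (exchange B k i j)))
                          (cong -_ (sym (matMut-≢ k B i j i≢k j≢k)))))

  tropMut-opp : ∀ k B x → tropMut k (opp B) x ≗ tropMut k B x
  tropMut-opp k B x j = cases (j Fin.≟ k)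
    where
    swap : tropMonomial⁻ k (opp B) x ≡ tropMonomial⁺ k B x
    swap = sum-cong-≗ (λ i → cong (λ b → + [ b ]₊ * x i) (ℤP.neg-involutive (B i k)))
    cases : Dec (j ≡ k) → tropMut k (opp B) x j ≡ tropMut k B x j
    cases (no j≢k)  = trans (tropMut-≢ k _ x j j≢k) (sym (tropMut-≢ k B x j j≢k))
    cases (yes refl) =
      trans (tropMut-≡ k (opp B) x)
            (trans (cong (λ m → (tropMonomial⁻ k B x ⊔ m) - x k) swap)
                   (trans (cong (_- x k) (ℤP.⊔-comm (tropMonomial⁻ k B x) (tropMonomial⁺ k B x)))
                          (sym (tropMut-≡ k B x))))

  matMutSeq-opp : ∀ ks B → matMutSeq ks (opp B) ≗₂ opp (matMutSeq ks B)
  matMutSeq-opp []       B i j = refl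
  matMutSeq-opp (k ∷ ks) B i j = trans (matMut-cong k (matMutSeq-opp ks B) i j) (matMut-opp k (matMutSeq ks B) i j)

  tropMutSeq-opp : ∀ ks B x → tropMutSeq (opp B) ks x ≗ tropMutSeq B ks x
  tropMutSeq-opp []       B x j = refl
  tropMutSeq-opp (k ∷ ks) B x j =
    trans (tropMut-cong k (matMutSeq-opp ks B) (tropMutSeq-opp ks B x) j) (tropMut-opp k (matMutSeq ks B) _ j)

  module _ (σ : Permutation′ 6) where

    permute : Mat → Mat
    permute B i j = B (σ ⟨$⟩ʳ i) (σ ⟨$⟩ʳ j)

    private
      σ-pivot : ∀ {i k} → i ≡ σ ⟨$⟩ˡ k → σ ⟨$⟩ʳ i ≡ k
      σ-pivot refl = Perm.inverseʳ σ

      σ-off-pivot : ∀ {i k} → i ≢ σ ⟨$⟩ˡ k → σ ⟨$⟩ʳ i ≢ k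
      σ-off-pivot i≢ eq = i≢ (trans (sym (Perm.inverseˡ σ)) (cong (σ ⟨$⟩ˡ_) eq))

    matMut-permute : ∀ k B → matMut (σ ⟨$⟩ˡ k) (permute B) ≗₂ permute (matMut k B)
    matMut-permute k B i j = cases (i Fin.≟ σ ⟨$⟩ˡ k) (j Fin.≟ σ ⟨$⟩ˡ k)
      where
      cases : Dec (i ≡ σ ⟨$⟩ˡ k) → Dec (j ≡ σ ⟨$⟩ˡ k) →
              matMut (σ ⟨$⟩ˡ k) (permute B) i j ≡ permute (matMut k B) i j
      cases (yes i≡k) _         = trans (matMut-≡ˡ _ _ i j i≡k) (sym (matMut-≡ˡ k B _ _ (σ-pivot i≡k)))
      cases (no _)    (yes j≡k) = trans (matMut-≡ʳ _ _ i j j≡k) (sym (matMut-≡ʳ k B _ _ (σ-pivot j≡k)))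
      cases (no i≢k)  (no j≢k)  =
        trans (matMut-≢ _ _ i j i≢k j≢k)
              (trans (cong (λ l → permute B i j + exchange B l (σ ⟨$⟩ʳ i) (σ ⟨$⟩ʳ j)) (Perm.inverseʳ σ))
                     (sym (matMut-≢ k B _ _ (σ-off-pivot i≢k) (σ-off-pivot j≢k))))

    tropMut-permute : ∀ k B x →
                      tropMut (σ ⟨$⟩ˡ k) (permute B) (x ∘ (σ ⟨$⟩ʳ_)) ≗ tropMut k B x ∘ (σ ⟨$⟩ʳ_)
    tropMut-permute k B x j = cases (j Fin.≟ σ ⟨$⟩ˡ k)
      where
      reindex : ∀ (c : ℤ → ℤ) → sum (λ i → + [ c (permute B i (σ ⟨$⟩ˡ k)) ]₊ * x (σ ⟨$⟩ʳ i))
                                ≡ sum (λ i → + [ c (B i k) ]₊ * x i)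
      reindex c =
        trans (sum-cong-≗ (λ i → cong (λ l → + [ c (B (σ ⟨$⟩ʳ i) l) ]₊ * x (σ ⟨$⟩ʳ i)) (Perm.inverseʳ σ {k})))
              (sym (sum-permute (λ i → + [ c (B i k) ]₊ * x i) σ))
      cases : Dec (j ≡ σ ⟨$⟩ˡ k) →
              tropMut (σ ⟨$⟩ˡ k) (permute B) (x ∘ (σ ⟨$⟩ʳ_)) j ≡ tropMut k B x (σ ⟨$⟩ʳ j)
      cases (no j≢k)  = trans (tropMut-≢ _ _ _ j j≢k) (sym (tropMut-≢ k B x _ (σ-off-pivot j≢k)))
      cases (yes refl) =
        trans (tropMut-≡ _ (permute B) (x ∘ (σ ⟨$⟩ʳ_)))
              (trans (cong₂ (λ m l → m - x l) (cong₂ _⊔_ (reindex (λ b → b)) (reindex (λ b → - b))) (Perm.inverseʳ σ))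
                     (trans (sym (tropMut-≡ k B x)) (cong (tropMut k B x) (sym (Perm.inverseʳ σ)))))

    matMutSeq-permute : ∀ ks B → matMutSeq (List.map (σ ⟨$⟩ˡ_) ks) (permute B) ≗₂ permute (matMutSeq ks B)
    matMutSeq-permute []       B i j = refl
    matMutSeq-permute (k ∷ ks) B i j =
      trans (matMut-cong _ (matMutSeq-permute ks B) i j) (matMut-permute k (matMutSeq ks B) i j)

    tropMutSeq-permute : ∀ ks B x →
                         tropMutSeq (permute B) (List.map (σ ⟨$⟩ˡ_) ks) (x ∘ (σ ⟨$⟩ʳ_)) ≗ tropMutSeq B ks x ∘ (σ ⟨$⟩ʳ_)
    tropMutSeq-permute []       B x j = refl
    tropMutSeq-permute (k ∷ ks) B x j =
      trans (tropMut-cong _ (matMutSeq-permute ks B) (tropMutSeq-permute ks B x) j)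
            (tropMut-permute k (matMutSeq ks B) (tropMutSeq B ks x) j)

open MutationSymmetries

module AffineForms where

  open import Data.Nat using (_≤_)
  open import Data.Integer using (_-_; _⊔_; +≤+)
  open import Data.Nat.Tactic.RingSolver using (solve-∀)
  open import Data.Vec.Properties using (lookup∘tabulate)

  data Form : Set where
    form : ℕ → ℕ → ℕ → Form

  infixl 6 _⊕_ _⊝_ _⊔ᶠ_
  infixr 7 _⊛_
  infix  4 _≤ᶠ_ _≤ᶠ?_

  ⟦_⟧ : Form → ℕ × ℕ → ℕ
  ⟦ form a b c ⟧ (p , q) = a ℕ.* p ℕ.+ b ℕ.* q ℕ.+ c

  _⊕_ : Form → Form → Form
  form a b c ⊕ form a′ b′ c′ = form (a ℕ.+ a′) (b ℕ.+ b′) (c ℕ.+ c′)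

  _⊛_ : ℕ → Form → Form
  n ⊛ form a b c = form (n ℕ.* a) (n ℕ.* b) (n ℕ.* c)

  _⊝_ : Form → Form → Form
  form a b c ⊝ form a′ b′ c′ = form (a ℕ.∸ a′) (b ℕ.∸ b′) (c ℕ.∸ c′)

  _⊔ᶠ_ : Form → Form → Form
  form a b c ⊔ᶠ form a′ b′ c′ = form (a ℕ.⊔ a′) (b ℕ.⊔ b′) (c ℕ.⊔ c′)

  _≤ᶠ_ : Form → Form → Set
  form a b c ≤ᶠ form a′ b′ c′ = a ≤ a′ × b ≤ b′ × c ≤ c′

  _≤ᶠ?_ : ∀ f g → Dec (f ≤ᶠ g)
  form a b c ≤ᶠ? form a′ b′ c′ = a ℕ.≤? a′ ×-dec b ℕ.≤? b′ ×-dec c ℕ.≤? c′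

  _≟ᶠ_ : ∀ (f g : Form) → Dec (f ≡ g)
  form a b c ≟ᶠ form a′ b′ c′ =
    map′ (λ { (refl , refl , refl) → refl }) (λ { refl → refl , refl , refl })
         (a ℕ.≟ a′ ×-dec b ℕ.≟ b′ ×-dec c ℕ.≟ c′)

  Comparable : Form → Form → Set
  Comparable f g = f ≤ᶠ g ⊎ g ≤ᶠ f

  ⟦⊕⟧ : ∀ f g x → ⟦ f ⊕ g ⟧ x ≡ ⟦ f ⟧ x ℕ.+ ⟦ g ⟧ x
  ⟦⊕⟧ (form a b c) (form a′ b′ c′) (p , q) = distrib a b c a′ b′ c′ p q
    where
    distrib : ∀ a b c a′ b′ c′ p q → (a ℕ.+ a′) ℕ.* p ℕ.+ (b ℕ.+ b′) ℕ.* q ℕ.+ (c ℕ.+ c′)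
                                    ≡ (a ℕ.* p ℕ.+ b ℕ.* q ℕ.+ c) ℕ.+ (a′ ℕ.* p ℕ.+ b′ ℕ.* q ℕ.+ c′)
    distrib = solve-∀

  ⟦⊛⟧ : ∀ n f x → ⟦ n ⊛ f ⟧ x ≡ n ℕ.* ⟦ f ⟧ x
  ⟦⊛⟧ n (form a b c) (p , q) = distrib n a b c p q
    where
    distrib : ∀ n a b c p q → n ℕ.* a ℕ.* p ℕ.+ n ℕ.* b ℕ.* q ℕ.+ n ℕ.* c ≡ n ℕ.* (a ℕ.* p ℕ.+ b ℕ.* q ℕ.+ c)
    distrib = solve-∀

  ⟦⟧-mono : ∀ {f g} x → f ≤ᶠ g → ⟦ f ⟧ x ≤ ⟦ g ⟧ x
  ⟦⟧-mono {form a b c} {form a′ b′ c′} (p , q) (a≤ , b≤ , c≤) =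
    ℕP.+-mono-≤ (ℕP.+-mono-≤ (ℕP.*-monoˡ-≤ p a≤) (ℕP.*-monoˡ-≤ q b≤)) c≤

  form-cong : ∀ {a b c a′ b′ c′} → a ≡ a′ → b ≡ b′ → c ≡ c′ → form a b c ≡ form a′ b′ c′
  form-cong refl refl refl = refl

  ⊝-⊕-cancel : ∀ {f g} → g ≤ᶠ f → (f ⊝ g) ⊕ g ≡ f
  ⊝-⊕-cancel {form _ _ _} {form _ _ _} (a≥ , b≥ , c≥) =
    form-cong (ℕP.m∸n+n≡m a≥) (ℕP.m∸n+n≡m b≥) (ℕP.m∸n+n≡m c≥)

  ⟦⊝⟧ : ∀ {f g} x → g ≤ᶠ f → + ⟦ f ⊝ g ⟧ x ≡ + ⟦ f ⟧ x - + ⟦ g ⟧ x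
  ⟦⊝⟧ {f} {g} x g≤f = begin
    + ⟦ f ⊝ g ⟧ x                            ≡⟨ cong +_ (ℕP.m+n∸n≡m (⟦ f ⊝ g ⟧ x) (⟦ g ⟧ x)) ⟨
    + (⟦ f ⊝ g ⟧ x ℕ.+ ⟦ g ⟧ x ℕ.∸ ⟦ g ⟧ x)  ≡⟨ cong (λ n → + (n ℕ.∸ ⟦ g ⟧ x)) cancel ⟩
    + (⟦ f ⟧ x ℕ.∸ ⟦ g ⟧ x)                  ≡⟨ ℤP.⊖-≥ (⟦⟧-mono x g≤f) ⟨
    ⟦ f ⟧ x ℤ.⊖ ⟦ g ⟧ x                      ≡⟨ ℤP.m-n≡m⊖n (⟦ f ⟧ x) (⟦ g ⟧ x) ⟨
    + ⟦ f ⟧ x - + ⟦ g ⟧ x                    ∎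
    where
    open ≡-Reasoning
    cancel : ⟦ f ⊝ g ⟧ x ℕ.+ ⟦ g ⟧ x ≡ ⟦ f ⟧ x
    cancel = trans (sym (⟦⊕⟧ (f ⊝ g) g x)) (cong (λ h → ⟦ h ⟧ x) (⊝-⊕-cancel g≤f))

  ⟦⊔ᶠ⟧ : ∀ {f g} x → Comparable f g → + ⟦ f ⊔ᶠ g ⟧ x ≡ + ⟦ f ⟧ x ⊔ + ⟦ g ⟧ x
  ⟦⊔ᶠ⟧ {form _ _ _} {form _ _ _} x (inj₁ f≤g@(a≤ , b≤ , c≤)) =
    trans (cong (λ h → + ⟦ h ⟧ x)
                (form-cong (ℕP.m≤n⇒m⊔n≡n a≤) (ℕP.m≤n⇒m⊔n≡n b≤) (ℕP.m≤n⇒m⊔n≡n c≤)))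
          (sym (ℤP.i≤j⇒i⊔j≡j (+≤+ (⟦⟧-mono x f≤g))))
  ⟦⊔ᶠ⟧ {form _ _ _} {form _ _ _} x (inj₂ g≤f@(a≥ , b≥ , c≥)) =
    trans (cong (λ h → + ⟦ h ⟧ x)
                (form-cong (ℕP.m≥n⇒m⊔n≡m a≥) (ℕP.m≥n⇒m⊔n≡m b≥) (ℕP.m≥n⇒m⊔n≡m c≥)))
          (sym (ℤP.i≥j⇒i⊔j≡i (+≤+ (⟦⟧-mono x g≤f))))

  formSum : ∀ {n} → (Fin n → ℕ) → (Fin n → Form) → Form
  formSum {zero}  c F = form 0 0 0
  formSum {suc n} c F = (c zero ⊛ F zero) ⊕ formSum (c ∘ suc) (F ∘ suc)

  ⟦formSum⟧ : ∀ {n} c (F : Fin n → Form) x → + ⟦ formSum c F ⟧ x ≡ sum (λ i → + c i ℤ.* + ⟦ F i ⟧ x)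
  ⟦formSum⟧ {zero}  c F (p , q) = refl
  ⟦formSum⟧ {suc n} c F x = begin
    + ⟦ (c zero ⊛ F zero) ⊕ formSum (c ∘ suc) (F ∘ suc) ⟧ x
      ≡⟨ cong +_ (⟦⊕⟧ (c zero ⊛ F zero) _ x) ⟩
    + (⟦ c zero ⊛ F zero ⟧ x ℕ.+ ⟦ formSum (c ∘ suc) (F ∘ suc) ⟧ x)
      ≡⟨ ℤP.pos-+ (⟦ c zero ⊛ F zero ⟧ x) _ ⟩
    + ⟦ c zero ⊛ F zero ⟧ x ℤ.+ + ⟦ formSum (c ∘ suc) (F ∘ suc) ⟧ x
      ≡⟨ cong₂ ℤ._+_ (trans (cong +_ (⟦⊛⟧ (c zero) (F zero) x)) (ℤP.pos-* (c zero) _))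
                     (⟦formSum⟧ (c ∘ suc) (F ∘ suc) x) ⟩
    + c zero ℤ.* + ⟦ F zero ⟧ x ℤ.+ sum (λ i → + c (suc i) ℤ.* + ⟦ F (suc i) ⟧ x) ∎
    where open ≡-Reasoning

  eval : (Fin 6 → Form) → ℕ × ℕ → Fin 6 → ℤ
  eval F x i = + ⟦ F i ⟧ x

  formMonomial⁺ formMonomial⁻ : Fin 6 → Mat → (Fin 6 → Form) → Form
  formMonomial⁺ k B F = formSum (λ i → [ B i k ]₊) F
  formMonomial⁻ k B F = formSum (λ i → [ ℤ.- B i k ]₊) F

  formMut : Fin 6 → Mat → (Fin 6 → Form) → (Fin 6 → Form)
  formMut k B F j with j Fin.≟ k
  ... | yes _ = (formMonomial⁺ k B F ⊔ᶠ formMonomial⁻ k B F) ⊝ F k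
  ... | no _  = F j

  -- ⊔ᶠ and ⊝ act coefficientwise, so they compute ⊔ and ∸ of the values only under these conditions.
  Resolved : Fin 6 → Mat → (Fin 6 → Form) → Set
  Resolved k B F = Comparable (formMonomial⁺ k B F) (formMonomial⁻ k B F)
                 × F k ≤ᶠ (formMonomial⁺ k B F ⊔ᶠ formMonomial⁻ k B F)

  -- Tabulating makes the entries shared, so that the decision procedures below evaluate iterated
  -- mutations in linear rather than exponential time.
  memo : ∀ {n} {A : Set} → (Fin n → A) → Fin n → A
  memo f = Vec.lookup (Vec.tabulate f)

  memoMatMutSeq : List (Fin 6) → Mat → Mat
  memoMatMutSeq []       B = B
  memoMatMutSeq (k ∷ ks) B = memo (memo ∘ matMut k (memoMatMutSeq ks B))

  memoMatMutSeq-correct : ∀ ks B → memoMatMutSeq ks B ≗₂ matMutSeq ks B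
  memoMatMutSeq-correct []       B i j = refl
  memoMatMutSeq-correct (k ∷ ks) B i j =
    trans (cong (λ r → r j) (lookup∘tabulate (memo ∘ matMut k (memoMatMutSeq ks B)) i))
          (trans (lookup∘tabulate (matMut k (memoMatMutSeq ks B) i) j)
                 (matMut-cong k (memoMatMutSeq-correct ks B) i j))

  formMutSeq : Mat → List (Fin 6) → (Fin 6 → Form) → (Fin 6 → Form)
  formMutSeq B []       F = F
  formMutSeq B (k ∷ ks) F = memo (formMut k (memoMatMutSeq ks B) (formMutSeq B ks F))

  ResolvedSeq : Mat → List (Fin 6) → (Fin 6 → Form) → Set
  ResolvedSeq B []       F = ⊤
  ResolvedSeq B (k ∷ ks) F = ResolvedSeq B ks F × Resolved k (memoMatMutSeq ks B) (formMutSeq B ks F)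

  resolvedSeq? : ∀ B ks F → Dec (ResolvedSeq B ks F)
  resolvedSeq? B []       F = yes tt
  resolvedSeq? B (k ∷ ks) F =
    resolvedSeq? B ks F ×-dec ((M⁺ ≤ᶠ? M⁻ ⊎-dec M⁻ ≤ᶠ? M⁺) ×-dec G k ≤ᶠ? (M⁺ ⊔ᶠ M⁻))
    where
    G  = formMutSeq B ks F
    M⁺ = formMonomial⁺ k (memoMatMutSeq ks B) G
    M⁻ = formMonomial⁻ k (memoMatMutSeq ks B) G

  tropMut-formMut : ∀ k B F x → Resolved k B F → tropMut k B (eval F x) ≗ eval (formMut k B F) x
  tropMut-formMut k B F x (comparable , nonneg) j with j Fin.≟ k
  ... | no _  = refl
  ... | yes _ = begin
    (tropMonomial⁺ k B (eval F x) ⊔ tropMonomial⁻ k B (eval F x)) - eval F x k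
      ≡⟨ cong (λ m → m - eval F x k) (cong₂ _⊔_ (sym (⟦formSum⟧ (λ i → [ B i k ]₊) F x))
                                                (sym (⟦formSum⟧ (λ i → [ ℤ.- B i k ]₊) F x))) ⟩
    (+ ⟦ formMonomial⁺ k B F ⟧ x ⊔ + ⟦ formMonomial⁻ k B F ⟧ x) - eval F x k
      ≡⟨ cong (λ m → m - eval F x k) (sym (⟦⊔ᶠ⟧ x comparable)) ⟩
    + ⟦ formMonomial⁺ k B F ⊔ᶠ formMonomial⁻ k B F ⟧ x - eval F x k
      ≡⟨ sym (⟦⊝⟧ x nonneg) ⟩
    + ⟦ (formMonomial⁺ k B F ⊔ᶠ formMonomial⁻ k B F) ⊝ F k ⟧ x ∎
    where open ≡-Reasoning

  tropMutSeq-formMutSeq : ∀ B ks F x → ResolvedSeq B ks F → tropMutSeq B ks (eval F x) ≗ eval (formMutSeq B ks F) x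
  tropMutSeq-formMutSeq B []       F x _                  j = refl
  tropMutSeq-formMutSeq B (k ∷ ks) F x (resolved , step) j =
    trans (tropMut-cong k (λ i j → sym (memoMatMutSeq-correct ks B i j)) (tropMutSeq-formMutSeq B ks F x resolved) j)
          (trans (tropMut-formMut k (memoMatMutSeq ks B) (formMutSeq B ks F) x step j)
                 (cong (λ f → + ⟦ f ⟧ x) (sym (lookup∘tabulate (formMut k (memoMatMutSeq ks B) (formMutSeq B ks F)) j))))

  _∘ᶠ_ : Form → Form × Form → Form
  form a b c ∘ᶠ (g₁ , g₂) = (a ⊛ g₁) ⊕ ((b ⊛ g₂) ⊕ form 0 0 c)

  ⟦_⟧² : Form × Form → ℕ × ℕ → ℕ × ℕ
  ⟦ g₁ , g₂ ⟧² x = ⟦ g₁ ⟧ x , ⟦ g₂ ⟧ x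

  ⟦∘ᶠ⟧ : ∀ f g x → ⟦ f ∘ᶠ g ⟧ x ≡ ⟦ f ⟧ (⟦ g ⟧² x)
  ⟦∘ᶠ⟧ (form a b c) (g₁ , g₂) x = begin
    ⟦ (a ⊛ g₁) ⊕ ((b ⊛ g₂) ⊕ form 0 0 c) ⟧ x
      ≡⟨ ⟦⊕⟧ (a ⊛ g₁) _ x ⟩
    ⟦ a ⊛ g₁ ⟧ x ℕ.+ ⟦ (b ⊛ g₂) ⊕ form 0 0 c ⟧ x
      ≡⟨ cong₂ ℕ._+_ (⟦⊛⟧ a g₁ x) (trans (⟦⊕⟧ (b ⊛ g₂) _ x) (cong (ℕ._+ c) (⟦⊛⟧ b g₂ x))) ⟩
    a ℕ.* ⟦ g₁ ⟧ x ℕ.+ (b ℕ.* ⟦ g₂ ⟧ x ℕ.+ c)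
      ≡⟨ sym (ℕP.+-assoc (a ℕ.* ⟦ g₁ ⟧ x) _ c) ⟩
    a ℕ.* ⟦ g₁ ⟧ x ℕ.+ b ℕ.* ⟦ g₂ ⟧ x ℕ.+ c ∎
    where open ≡-Reasoning

open AffineForms

module X6Cycles where

  -- Two mutation cycles of X6 (read right to left, as in seedAt).  Each returns X6 to itself and
  -- takes the tropical point family at (p , q) to family at ⟦ move l ⟧² (p , q).
  data Letter : Set where
    g h : Letter

  cycle : Letter → List (Fin 6)
  cycle g = 5F ∷ 2F ∷ 5F ∷ 4F ∷ 2F ∷ 5F ∷ 3F ∷ 5F ∷ []
  cycle h = 0F ∷ 1F ∷ 2F ∷ 4F ∷ 5F ∷ 2F ∷ 1F ∷ 0F ∷ []

  move : Letter → Form × Form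
  move g = form 1 0 0 , form 2 1 2
  move h = form 1 2 1 , form 0 1 0

  family : Fin 6 → Form
  family 0F = form 4 0 4
  family 1F = form 2 0 2
  family 2F = form 2 0 2
  family 3F = form 0 2 1
  family 4F = form 2 2 3
  family 5F = form 2 0 2

  skew-X6 : Skew X6
  skew-X6 = from-yes (all? λ i → all? λ j → X6 j i ℤ.≟ ℤ.- X6 i j)

  cycle-fixes-X6 : ∀ l → matMutSeq (cycle l) X6 ≗₂ X6
  cycle-fixes-X6 l i j = trans (sym (memoMatMutSeq-correct (cycle l) X6 i j)) (fixed l i j)
    where
    fixed : ∀ l → memoMatMutSeq (cycle l) X6 ≗₂ X6
    fixed g = from-yes (all? λ i → all? λ j → memoMatMutSeq (cycle g) X6 i j ℤ.≟ X6 i j)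
    fixed h = from-yes (all? λ i → all? λ j → memoMatMutSeq (cycle h) X6 i j ℤ.≟ X6 i j)

  cycle-resolved : ∀ l → ResolvedSeq X6 (cycle l) family
  cycle-resolved g = from-yes (resolvedSeq? X6 (cycle g) family)
  cycle-resolved h = from-yes (resolvedSeq? X6 (cycle h) family)

  cycle-moves : ∀ l → formMutSeq X6 (cycle l) family ≗ λ i → family i ∘ᶠ move l
  cycle-moves g = from-yes (all? λ i → formMutSeq X6 (cycle g) family i ≟ᶠ (family i ∘ᶠ move g))
  cycle-moves h = from-yes (all? λ i → formMutSeq X6 (cycle h) family i ≟ᶠ (family i ∘ᶠ move h))

  path : List Letter → List (Fin 6)
  path []      = []
  path (l ∷ u) = cycle l ++ path u

  params : List Letter → ℕ × ℕ
  params []      = 0 , 0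
  params (l ∷ u) = ⟦ move l ⟧² (params u)

  matMutSeq-path : ∀ u → matMutSeq (path u) X6 ≗₂ X6
  matMutSeq-path []      i j = refl
  matMutSeq-path (l ∷ u) i j =
    trans (cong (λ M → M i j) (matMutSeq-++ (cycle l) (path u) X6))
          (trans (matMutSeq-cong (cycle l) (matMutSeq-path u) i j) (cycle-fixes-X6 l i j))

  tropMutSeq-cycle : ∀ l x → tropMutSeq X6 (cycle l) (eval family x) ≗ eval family (⟦ move l ⟧² x)
  tropMutSeq-cycle l x i =
    trans (tropMutSeq-formMutSeq X6 (cycle l) family x (cycle-resolved l) i)
          (cong ℤ.+_ (trans (cong (λ f → ⟦ f ⟧ x) (cycle-moves l i)) (⟦∘ᶠ⟧ (family i) (move l) x)))

  tropMutSeq-path : ∀ u → tropMutSeq X6 (path u) (eval family (0 , 0)) ≗ eval family (params u)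
  tropMutSeq-path []      i = refl
  tropMutSeq-path (l ∷ u) i =
    trans (tropMutSeq-++ (cycle l) (path u) X6 _ i)
          (trans (tropMutSeq-cong (cycle l) (matMutSeq-path u) (tropMutSeq-path u) i)
                 (tropMutSeq-cycle l (params u) i))

  length-path : ∀ u → length (path u) ≡ 8 ℕ.* length u
  length-path []      = refl
  length-path (l ∷ u) =
    trans (List.length-++ (cycle l)) (trans (cong₂ ℕ._+_ (length-cycle l) (length-path u)) (sym (ℕP.*-suc 8 (length u))))
    where
    length-cycle : ∀ l → length (cycle l) ≡ 8
    length-cycle g = refl
    length-cycle h = refl

open X6Cycles

module Injectivity where

  open import Data.Nat using (_≤_; _<_; s≤s)
  open import Data.Nat.Tactic.RingSolver using (solve-∀)

  -- The even values of the family are at most the value at c, the odd ones at most the value at b₂.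
  data Parity (F : Form) : Set where
    even : ∀ f → f ≤ᶠ form 2 0 2 → F ≡ 2 ⊛ f → Parity F
    odd  : ∀ f → f ≤ᶠ form 1 1 1 → F ≡ (2 ⊛ f) ⊕ form 0 0 1 → Parity F

  family-parity : ∀ i → Parity (family i)
  family-parity 0F = even (form 2 0 2) (from-yes (form 2 0 2 ≤ᶠ? form 2 0 2)) refl
  family-parity 1F = even (form 1 0 1) (from-yes (form 1 0 1 ≤ᶠ? form 2 0 2)) refl
  family-parity 2F = even (form 1 0 1) (from-yes (form 1 0 1 ≤ᶠ? form 2 0 2)) refl
  family-parity 3F = odd  (form 0 1 0) (from-yes (form 0 1 0 ≤ᶠ? form 1 1 1)) refl
  family-parity 4F = odd  (form 1 1 1) (from-yes (form 1 1 1 ≤ᶠ? form 1 1 1)) refl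
  family-parity 5F = even (form 1 0 1) (from-yes (form 1 0 1 ≤ᶠ? form 2 0 2)) refl

  ⟦odd⟧ : ∀ f x → ⟦ (2 ⊛ f) ⊕ form 0 0 1 ⟧ x ≡ suc (2 ℕ.* ⟦ f ⟧ x)
  ⟦odd⟧ f x = trans (⟦⊕⟧ (2 ⊛ f) (form 0 0 1) x) (trans (cong (ℕ._+ 1) (⟦⊛⟧ 2 f x)) (ℕP.+-comm _ 1))

  even≢odd : ∀ f f′ x y → ⟦ 2 ⊛ f ⟧ x ≢ ⟦ (2 ⊛ f′) ⊕ form 0 0 1 ⟧ y
  even≢odd f f′ x y eq = ℕP.even≢odd (⟦ f ⟧ x) (⟦ f′ ⟧ y) (trans (sym (⟦⊛⟧ 2 f x)) (trans eq (⟦odd⟧ f′ y)))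

  top-even : ∀ x y j → ⟦ family 0F ⟧ x ≡ ⟦ family j ⟧ y → ⟦ family 0F ⟧ x ≤ ⟦ family 0F ⟧ y
  top-even x y j eq with family j | family-parity j
  ... | _ | even f f≤ refl = begin
    ⟦ family 0F ⟧ x         ≡⟨ eq ⟩
    ⟦ 2 ⊛ f ⟧ y             ≡⟨ ⟦⊛⟧ 2 f y ⟩
    2 ℕ.* ⟦ f ⟧ y           ≤⟨ ℕP.*-monoʳ-≤ 2 (⟦⟧-mono y f≤) ⟩
    2 ℕ.* ⟦ form 2 0 2 ⟧ y  ≡⟨ ⟦⊛⟧ 2 (form 2 0 2) y ⟨
    ⟦ family 0F ⟧ y         ∎
    where open ℕP.≤-Reasoning
  ... | _ | odd f _ refl    = ⊥-elim (even≢odd (form 2 0 2) f x y eq)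

  top-odd : ∀ x y j → ⟦ family 4F ⟧ x ≡ ⟦ family j ⟧ y → ⟦ family 4F ⟧ x ≤ ⟦ family 4F ⟧ y
  top-odd x y j eq with family j | family-parity j
  ... | _ | even f _ refl  = ⊥-elim (even≢odd f (form 1 1 1) y x (sym eq))
  ... | _ | odd f f≤ refl  = begin
    ⟦ family 4F ⟧ x                    ≡⟨ eq ⟩
    ⟦ (2 ⊛ f) ⊕ form 0 0 1 ⟧ y         ≡⟨ ⟦odd⟧ f y ⟩
    suc (2 ℕ.* ⟦ f ⟧ y)                ≤⟨ s≤s (ℕP.*-monoʳ-≤ 2 (⟦⟧-mono y f≤)) ⟩
    suc (2 ℕ.* ⟦ form 1 1 1 ⟧ y)       ≡⟨ ⟦odd⟧ (form 1 1 1) y ⟨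
    ⟦ family 4F ⟧ y                    ∎
    where open ℕP.≤-Reasoning

  family-injective : ∀ x y → SameValues (eval family x) (eval family y) → x ≡ y
  family-injective x@(p , q) y@(p′ , q′) (x⊆y , y⊆x) = cong₂ _,_ p≡p′ q≡q′
    where
    top : ∀ i → (∀ x y j → ⟦ family i ⟧ x ≡ ⟦ family j ⟧ y → ⟦ family i ⟧ x ≤ ⟦ family i ⟧ y) →
          ⟦ family i ⟧ x ≡ ⟦ family i ⟧ y
    top i bound = ℕP.≤-antisym (bound x y (proj₁ (x⊆y i)) (ℤP.+-injective (proj₂ (x⊆y i))))
                               (bound y x (proj₁ (y⊆x i)) (ℤP.+-injective (proj₂ (y⊆x i))))
    c-value : ∀ p q → 4 ℕ.* p ℕ.+ 0 ℕ.* q ℕ.+ 4 ≡ 4 ℕ.* p ℕ.+ 4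
    c-value = solve-∀
    p≡p′ : p ≡ p′
    p≡p′ = ℕP.*-cancelˡ-≡ p p′ 4 (ℕP.+-cancelʳ-≡ 4 (4 ℕ.* p) (4 ℕ.* p′)
             (trans (sym (c-value p q)) (trans (top 0F top-even) (c-value p′ q′))))
    q≡q′ : q ≡ q′
    q≡q′ = ℕP.*-cancelˡ-≡ q q′ 2 (ℕP.+-cancelˡ-≡ (2 ℕ.* p) (2 ℕ.* q) (2 ℕ.* q′) (ℕP.+-cancelʳ-≡ 3 _ _ (begin
      ⟦ family 4F ⟧ x              ≡⟨ top 4F top-odd ⟩
      ⟦ family 4F ⟧ y              ≡⟨ cong (λ z → 2 ℕ.* z ℕ.+ 2 ℕ.* q′ ℕ.+ 3) p≡p′ ⟨
      2 ℕ.* p ℕ.+ 2 ℕ.* q′ ℕ.+ 3   ∎)))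
      where open ≡-Reasoning

  ⟦⟧-mono-< : ∀ {f f′} x → f ⊕ form 0 0 1 ≤ᶠ f′ → ⟦ f ⟧ x < ⟦ f′ ⟧ x
  ⟦⟧-mono-< {f} {f′} x le = subst (_≤ ⟦ f′ ⟧ x) (trans (⟦⊕⟧ f (form 0 0 1) x) (ℕP.+-comm _ 1)) (⟦⟧-mono x le)

  Region : Letter → ℕ × ℕ → Set
  Region g (p , q) = p < q
  Region h (p , q) = q < p

  move-region : ∀ l x → Region l (⟦ move l ⟧² x)
  move-region g x = ⟦⟧-mono-< {form 1 0 0} {form 2 1 2} x (from-yes (form 1 0 1 ≤ᶠ? form 2 1 2))
  move-region h x = ⟦⟧-mono-< {form 0 1 0} {form 1 2 1} x (from-yes (form 0 1 1 ≤ᶠ? form 1 2 1))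

  origin-∉-region : ∀ l → ¬ Region l (0 , 0)
  origin-∉-region g ()
  origin-∉-region h ()

  regions-disjoint : ∀ {x} → Region g x → ¬ Region h x
  regions-disjoint = ℕP.<-asym

  move-injective : ∀ l {x y} → ⟦ move l ⟧² x ≡ ⟦ move l ⟧² y → x ≡ y
  move-injective g {p , q} {p′ , q′} eq = cong₂ _,_ p≡p′ q≡q′
    where
    first : ∀ p q → 1 ℕ.* p ℕ.+ 0 ℕ.* q ℕ.+ 0 ≡ p
    first = solve-∀
    p≡p′ : p ≡ p′
    p≡p′ = trans (sym (first p q)) (trans (cong proj₁ eq) (first p′ q′))
    q≡q′ : q ≡ q′
    q≡q′ = ℕP.*-cancelˡ-≡ q q′ 1 (ℕP.+-cancelˡ-≡ (2 ℕ.* p) _ _ (ℕP.+-cancelʳ-≡ 2 _ _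
             (trans (cong proj₂ eq) (cong (λ z → 2 ℕ.* z ℕ.+ 1 ℕ.* q′ ℕ.+ 2) (sym p≡p′)))))
  move-injective h {p , q} {p′ , q′} eq = cong₂ _,_ p≡p′ q≡q′
    where
    second : ∀ p q → 0 ℕ.* p ℕ.+ 1 ℕ.* q ℕ.+ 0 ≡ q
    second = solve-∀
    q≡q′ : q ≡ q′
    q≡q′ = trans (sym (second p q)) (trans (cong proj₂ eq) (second p′ q′))
    p≡p′ : p ≡ p′
    p≡p′ = ℕP.*-cancelˡ-≡ p p′ 1 (ℕP.+-cancelʳ-≡ (2 ℕ.* q) _ _ (ℕP.+-cancelʳ-≡ 1 _ _
             (trans (cong proj₁ eq) (cong (λ z → 1 ℕ.* p′ ℕ.+ 2 ℕ.* z ℕ.+ 1) (sym q≡q′)))))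

  params-injective : ∀ u t → params u ≡ params t → u ≡ t
  params-injective []      []      _  = refl
  params-injective []      (l ∷ t) eq = ⊥-elim (origin-∉-region l (subst (Region l) (sym eq) (move-region l (params t))))
  params-injective (l ∷ u) []      eq = ⊥-elim (origin-∉-region l (subst (Region l) eq (move-region l (params u))))
  params-injective (g ∷ u) (g ∷ t) eq = cong (g ∷_) (params-injective u t (move-injective g eq))
  params-injective (h ∷ u) (h ∷ t) eq = cong (h ∷_) (params-injective u t (move-injective h eq))
  params-injective (g ∷ u) (h ∷ t) eq =
    ⊥-elim (regions-disjoint (move-region g (params u)) (subst (Region h) (sym eq) (move-region h (params t))))
  params-injective (h ∷ u) (g ∷ t) eq =
    ⊥-elim (regions-disjoint (move-region g (params t)) (subst (Region h) eq (move-region h (params u))))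

open Injectivity

module Counting where

  open import Data.Nat using (_+_; _*_; _^_; _≤_; _<_; _≤′_; NonZero)
  open import Data.Nat.DivMod using (_%_; m≡m%n+[m/n]*n; m%n<n) renaming (_/_ to _div_)
  open import Data.Nat.Tactic.RingSolver using (solve-∀)

  words : ℕ → List (List Letter)
  words zero    = [] ∷ []
  words (suc n) = List.map (g ∷_) (words n) ++ List.map (h ∷_) (words n)

  length-words : ∀ n → length (words n) ≡ 2 ^ n
  length-words zero    = refl
  length-words (suc n) = begin
    length (List.map (g ∷_) (words n) ++ List.map (h ∷_) (words n))  ≡⟨ List.length-++ (List.map (g ∷_) (words n)) ⟩
    length (List.map (g ∷_) (words n)) + length (List.map (h ∷_) (words n))
      ≡⟨ cong₂ _+_ (List.length-map (g ∷_) (words n)) (List.length-map (h ∷_) (words n)) ⟩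
    length (words n) + length (words n)                                ≡⟨ cong (λ m → m + m) (length-words n) ⟩
    2 ^ n + 2 ^ n                                                      ≡⟨ cong (λ m → 2 ^ n + m) (ℕP.+-identityʳ (2 ^ n)) ⟨
    2 ^ suc n                                                          ∎
    where open ≡-Reasoning

  words-length : ∀ n → All (λ u → length u ≡ n) (words n)
  words-length zero    = refl ∷ []
  words-length (suc n) = All.++⁺ (All.map⁺ (All.map (cong suc) (words-length n)))
                                 (All.map⁺ (All.map (cong suc) (words-length n)))

  words-distinct : ∀ n → AllPairs _≢_ (words n)
  words-distinct zero    = [] ∷ []
  words-distinct (suc n) = AllPairs.++⁺ (prefix g) (prefix h)
    (All.map⁺ (All.universal (λ _ → All.map⁺ (All.universal (λ _ ()) (words n))) (words n)))
    where
    prefix : ∀ l → AllPairs _≢_ (List.map (l ∷_) (words n))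
    prefix l = AllPairs.map⁺ (AllPairs.map (λ u≢t eq → u≢t (List.∷-injectiveʳ eq)) (words-distinct n))

  module _ (B : Mat) where

    same-refl : ∀ s → Same B s s
    same-refl s = (λ i → i , λ m → refl) , (λ i → i , λ m → refl)

    within-length : ∀ s → Within B (length s) s
    within-length []      = same-refl []
    within-length (k ∷ s) = inj₂ (s , s , k , within-length s , same-refl s , same-refl (k ∷ s))

    within-≤′ : ∀ {M N} s → M ≤′ N → Within B M s → Within B N s
    within-≤′ s ℕ.≤′-refl       w = w
    within-≤′ s (ℕ.≤′-step M≤N) w = inj₁ (within-≤′ s M≤N w)

    within-≤ : ∀ {N} s → length s ≤ N → Within B N s
    within-≤ s le = within-≤′ s (ℕP.≤⇒≤′ le) (within-length s)

  pow-ratio : ∀ {x y c b m} .{{_ : NonZero y}} → y ≤ x → b ≤ m → x ^ m ≤ c * y ^ m → x ^ b ≤ c * y ^ b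
  pow-ratio {x} {y} {c} {b} {m} y≤x b≤m xᵐ≤ = ℕP.*-cancelʳ-≤ (x ^ b) (c * y ^ b) (y ^ d) {{ℕP.m^n≢0 y d}} (begin
    x ^ b * y ^ d        ≤⟨ ℕP.*-monoʳ-≤ (x ^ b) (ℕP.^-monoˡ-≤ d y≤x) ⟩
    x ^ b * x ^ d        ≡⟨ ℕP.^-distribˡ-+-* x b d ⟨
    x ^ (b + d)          ≡⟨ cong (x ^_) b+d≡m ⟩
    x ^ m                ≤⟨ xᵐ≤ ⟩
    c * y ^ m            ≡⟨ cong (λ e → c * y ^ e) b+d≡m ⟨
    c * y ^ (b + d)      ≡⟨ cong (c *_) (ℕP.^-distribˡ-+-* y b d) ⟩
    c * (y ^ b * y ^ d)  ≡⟨ ℕP.*-assoc c (y ^ b) (y ^ d) ⟨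
    c * y ^ b * y ^ d    ∎)
    where
    open ℕP.≤-Reasoning
    d = m ℕ.∸ b
    b+d≡m : b + d ≡ m
    b+d≡m = ℕP.m+[n∸m]≡n b≤m

  pow-blocks : ∀ {x y c m b} → x ^ m ≤ c * y ^ m → x ^ b ≤ c * y ^ b →
               ∀ a → x ^ (a * m + b) ≤ c ^ suc a * y ^ (a * m + b)
  pow-blocks {x} {y} {c} {m} {b} xᵐ≤ xᵇ≤ zero    = subst (x ^ b ≤_) (cong (_* y ^ b) (sym (ℕP.*-identityʳ c))) xᵇ≤
  pow-blocks {x} {y} {c} {m} {b} xᵐ≤ xᵇ≤ (suc a) = begin
    x ^ (m + a * m + b)                    ≡⟨ cong (x ^_) (ℕP.+-assoc m (a * m) b) ⟩
    x ^ (m + E)                            ≡⟨ ℕP.^-distribˡ-+-* x m E ⟩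
    x ^ m * x ^ E                          ≤⟨ ℕP.*-mono-≤ xᵐ≤ (pow-blocks {x} {y} {c} {m} {b} xᵐ≤ xᵇ≤ a) ⟩
    c * y ^ m * (c ^ suc a * y ^ E)        ≡⟨ regroup c (y ^ m) (c ^ suc a) (y ^ E) ⟩
    c * c ^ suc a * (y ^ m * y ^ E)        ≡⟨ cong (c * c ^ suc a *_) (ℕP.^-distribˡ-+-* y m E) ⟨
    c ^ suc (suc a) * y ^ (m + E)          ≡⟨ cong (λ e → c ^ suc (suc a) * y ^ e) (ℕP.+-assoc m (a * m) b) ⟨
    c ^ suc (suc a) * y ^ (m + a * m + b)  ∎
    where
    open ℕP.≤-Reasoning
    E = a * m + b
    regroup : ∀ c Y C Z → c * Y * (C * Z) ≡ c * C * (Y * Z)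
    regroup = solve-∀

  -- (24/23)^16 < 2, and only half of each block of 16 steps is spent on cycles of length 8.
  exponential-growth : ∀ (P : ℕ → ℕ → Set) K → (∀ n N → 8 * n + K ≤ N → P N (2 ^ n)) →
                       ∀ N → 16 * suc K ≤ N → Σ ℕ λ L → P N L × 24 ^ N ≤ L * 23 ^ N
  exponential-growth P K doubling N N₀≤N = 2 ^ suc a , doubling (suc a) N cycles-fit , bound
    where
    a = N div 16
    b = N % 16
    N≡ : N ≡ a * 16 + b
    N≡ = trans (m≡m%n+[m/n]*n N 16) (ℕP.+-comm b (a * 16))
    bound : 24 ^ N ≤ 2 ^ suc a * 23 ^ N
    bound = subst (λ e → 24 ^ e ≤ 2 ^ suc a * 23 ^ e) (sym N≡) (pow-blocks {24} {23} {2} {16} {b} ratio remainder a)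
      where
      ratio : 24 ^ 16 ≤ 2 * 23 ^ 16
      ratio = from-yes (24 ^ 16 ℕP.≤? 2 * 23 ^ 16)
      remainder : 24 ^ b ≤ 2 * 23 ^ b
      remainder = pow-ratio {24} {23} {2} {b} {16} (ℕP.n≤1+n 23) (ℕP.<⇒≤ (m%n<n N 16)) ratio
    K<a : K < a
    K<a = ℕP.≤-pred (ℕP.*-cancelˡ-< 16 (suc K) (suc a) (begin-strict
      16 * suc K       ≤⟨ N₀≤N ⟩
      N                ≡⟨ N≡ ⟩
      a * 16 + b       <⟨ ℕP.+-monoʳ-< (a * 16) (m%n<n N 16) ⟩
      a * 16 + 16      ≡⟨ rearrange a ⟩
      16 * suc a       ∎))
      where
      open ℕP.≤-Reasoning
      rearrange : ∀ a → a * 16 + 16 ≡ 16 * suc a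
      rearrange = solve-∀
    cycles-fit : 8 * suc a + K ≤ N
    cycles-fit = begin
      8 * suc a + K     ≤⟨ ℕP.+-monoʳ-≤ (8 * suc a) (ℕP.m≤n*m K 8) ⟩
      8 * suc a + 8 * K ≡⟨ shift a K ⟩
      8 * a + 8 * suc K ≤⟨ ℕP.+-monoʳ-≤ (8 * a) (ℕP.*-monoʳ-≤ 8 K<a) ⟩
      8 * a + 8 * a     ≡⟨ double a ⟩
      a * 16            ≤⟨ ℕP.m≤m+n (a * 16) b ⟩
      a * 16 + b        ≡⟨ N≡ ⟨
      N                 ∎
      where
      open ℕP.≤-Reasoning
      shift : ∀ a K → 8 * suc a + 8 * K ≡ 8 * a + 8 * suc K
      shift = solve-∀
      double : ∀ a → 8 * a + 8 * a ≡ a * 16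
      double = solve-∀

open Counting

module Growth where

  open import Data.Nat using (_+_; _*_; _^_; _≤_; z≤n; s≤s)

  module _ (B : Mat) (ks : List (Fin 6)) (σ : Permutation′ 6) (X : Mat) (skew : Skew X)
           (tropMutSeq-path-X : ∀ u → tropMutSeq X (path u) (eval family (0 , 0)) ≗ eval family (params u))
           (B≡ : ∀ i j → B i j ≡ matMutSeq ks X (σ ⟨$⟩ʳ i) (σ ⟨$⟩ʳ j)) where

    private
      M = matMutSeq ks X
      w = tropMutSeq X ks (eval family (0 , 0))

    -- Chosen so that mutating back along reverse ks lands on the point family at (0 , 0) of X.
    weight : Fin 6 → ℤ
    weight = w ∘ (σ ⟨$⟩ʳ_)

    vertex : List Letter → List (Fin 6)
    vertex u = List.map (σ ⟨$⟩ˡ_) (path u ++ List.reverse ks)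

    tropMutSeq-vertex : ∀ u → tropMutSeq B (vertex u) weight ≗ eval family (params u) ∘ (σ ⟨$⟩ʳ_)
    tropMutSeq-vertex u i = begin
      tropMutSeq B (vertex u) weight i
        ≡⟨ tropMutSeq-cong (vertex u) B≡ (λ _ → refl) i ⟩
      tropMutSeq (permute σ M) (vertex u) weight i
        ≡⟨ tropMutSeq-permute σ (path u ++ List.reverse ks) M w i ⟩
      tropMutSeq M (path u ++ List.reverse ks) w (σ ⟨$⟩ʳ i)
        ≡⟨ tropMutSeq-++ (path u) (List.reverse ks) M w _ ⟩
      tropMutSeq (matMutSeq (List.reverse ks) M) (path u) (tropMutSeq M (List.reverse ks) w) (σ ⟨$⟩ʳ i)
        ≡⟨ tropMutSeq-cong (path u) (matMutSeq-reverse ks X) (tropMutSeq-reverse ks skew _) _ ⟩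
      tropMutSeq X (path u) (eval family (0 , 0)) (σ ⟨$⟩ʳ i)
        ≡⟨ tropMutSeq-path-X u _ ⟩
      eval family (params u) (σ ⟨$⟩ʳ i) ∎
      where open ≡-Reasoning

    vertices-distinct : ∀ {u t} → u ≢ t → ¬ Same B (vertex u) (vertex t)
    vertices-distinct {u} {t} u≢t same = u≢t (params-injective u t (family-injective _ _
      (sameValues-permute σ (sameValues-cong (tropMutSeq-vertex u) (tropMutSeq-vertex t)
        (same⇒sameValues weight B (vertex u) (vertex t) same)))))

    length-vertex : ∀ u → length (vertex u) ≡ 8 * length u + length ks
    length-vertex u = trans (List.length-map _ (path u ++ List.reverse ks))
      (trans (List.length-++ (path u)) (cong₂ _+_ (length-path u) (List.length-reverse ks)))

    atLeast : ∀ n N → 8 * n + length ks ≤ N → AtLeast B N (2 ^ n)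
    atLeast n N fits =
      List.map vertex (words n) ,
      ℕP.≤-reflexive (sym (trans (List.length-map vertex (words n)) (length-words n))) ,
      All.map⁺ (All.map (λ {u} → within {u}) (words-length n)) ,
      AllPairs.map⁺ (AllPairs.map vertices-distinct (words-distinct n))
      where
      within : ∀ {u} → length u ≡ n → Within B N (vertex u)
      within {u} refl = within-≤ B (vertex u) (subst (_≤ N) (sym (length-vertex u)) fits)

    expGrowth : ExpGrowth B
    expGrowth = 24 , 23 , s≤s z≤n , ℕP.≤-refl , 16 * suc (length ks) , exponential-growth (AtLeast B) (length ks) atLeast

open Growth

lemma5p6 : (B : Mat) → TypeX6 B → ExpGrowth B
lemma5p6 B (ks , σ , inj₁ B≡) = expGrowth B ks σ X6 skew-X6 tropMutSeq-path B≡
lemma5p6 B (ks , σ , inj₂ B≡) = expGrowth B ks σ (opp X6) (skew-opp skew-X6) tropMutSeq-path-opp B≡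
  where
  tropMutSeq-path-opp : ∀ u → tropMutSeq (opp X6) (path u) (eval family (0 , 0)) ≗ eval family (params u)
  tropMutSeq-path-opp u i = trans (tropMutSeq-opp (path u) X6 _ i) (tropMutSeq-path u i)
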